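{- Let $\mathfrak a_{n,m}$ be the number of $\sigma\in\mathcal{I}_n(011,120)$ with $\max(\sigma)=m$. Let $\mathfrak b_{n,k}$ be the number of words $\omega\in\mathcal W_{n,k}$ avoiding $120$ in which all letters are distinct. Let $\mathfrak c_{n,k}$ be the number of words $\omega\in\mathcal W_{n,k}$ avoiding $120$ in which no nonzero letter is repeated (i.e. $\omega_i=\omega_j\neq 0$ implies $i=j$). Then for all integers $0<m<n$, $$\mathfrak a_{n,m}=\sum_{p=m+1}^{n}\Big(\mathfrak c_{n-p,m}+\sum_{j=1}^{m-1}\mathfrak a_{p-1,j}\,\mathfrak b_{n-p,m-j-1}\Big).$$
   Context: For $n\in\mathbb N$, an inversion sequence of size $n$ is a sequence $\sigma=(\sigma_1,\dots,\sigma_n)\in\mathbb N^n$ with $\sigma_i<i$ for all $i$. An integer sequence contains a pattern $\rho$ (a finite integer sequence such as $011$ or $120$) if it has a subsequence order-isomorphic to $\rho$, and avoids $\rho$ otherwise. $\mathcal{I}_n(P)$ denotes the set of inversion sequences of size $n$ avoiding every pattern in the set $P$. $\mathcal W_{n,k}=\{0,\dots,k-1\}^n$ is the set of words of length $n$ over the alphabet $\{0,\dots,k-1\}$. $\max(\sigma)$ is the largest entry of $\sigma$. -}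

module Defs where

open import Data.Nat using (ℕ; zero; suc; _+_; _∸_; _*_; _⊔_; _<ᵇ_; _≡ᵇ_)
open import Data.Bool using (Bool; true; false; _∧_; _∨_; not; if_then_else_)
open import Data.List using (List; []; _∷_; map; filter; length; concatMap; applyUpTo; foldr; zip)
open import Data.Bool.ListAction using (all; any)
open import Data.Nat.ListAction using (sum)
open import Data.Product using (_×_; _,_)
open import Relation.Nullary.Decidable using (yes; no)
open import Data.Bool.Properties using (T?)

same-rel : ℕ → ℕ → ℕ → ℕ → Bool
same-rel x x' y y' = ((x <ᵇ x') ≡ᵇB (y <ᵇ y')) ∧ ((x ≡ᵇ x') ≡ᵇB (y ≡ᵇ y'))
  where
  _≡ᵇB_ : Bool → Bool → Bool
  true  ≡ᵇB b = b
  false ≡ᵇB b = not b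

orderIso : List ℕ → List ℕ → Bool
orderIso [] [] = true
orderIso (x ∷ xs) (y ∷ ys) =
  all (λ { (x' , y') → same-rel x x' y y' }) (zip xs ys) ∧ orderIso xs ys
orderIso _ _ = false

subseqs : List ℕ → List (List ℕ)
subseqs [] = [] ∷ []
subseqs (x ∷ xs) = let r = subseqs xs in map (x ∷_) r Data.List.++ r

contains : List ℕ → List ℕ → Bool
contains ρ σ = any (orderIso ρ) (subseqs σ)

avoids : List ℕ → List ℕ → Bool
avoids ρ σ = not (contains ρ σ)

-- all sequences (ω₁,…,ωₙ) with ωᵢ < bound i (i is 1-based)
seqsBounded : (ℕ → ℕ) → ℕ → List (List ℕ)
seqsBounded b zero = [] ∷ []
seqsBounded b (suc n) =
  concatMap (λ s → map (λ v → s Data.List.++ (v ∷ [])) (applyUpTo (λ v → v) (b (suc n))))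
            (seqsBounded b n)

invSeqs : ℕ → List (List ℕ)
invSeqs = seqsBounded (λ i → i)

-- W_{n,k} = {0,…,k-1}^n
words : ℕ → ℕ → List (List ℕ)
words n k = seqsBounded (λ _ → k) n

maxL : List ℕ → ℕ
maxL = foldr _⊔_ 0

count : (List ℕ → Bool) → List (List ℕ) → ℕ
count P xs = length (filter (λ x → T? (P x)) xs)

pat011 pat120 : List ℕ
pat011 = 0 ∷ 1 ∷ 1 ∷ []
pat120 = 1 ∷ 2 ∷ 0 ∷ []

occurs : ℕ → List ℕ → ℕ
occurs a = foldr (λ x r → if x ≡ᵇ a then suc r else r) 0

allDistinct : List ℕ → Bool
allDistinct [] = true
allDistinct (x ∷ xs) = (occurs x xs ≡ᵇ 0) ∧ allDistinct xs

nonzeroDistinct : List ℕ → Bool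
nonzeroDistinct [] = true
nonzeroDistinct (x ∷ xs) = ((x ≡ᵇ 0) ∨ (occurs x xs ≡ᵇ 0)) ∧ nonzeroDistinct xs

𝔞 : ℕ → ℕ → ℕ
𝔞 n m = count (λ σ → avoids pat011 σ ∧ avoids pat120 σ ∧ (maxL σ ≡ᵇ m)) (invSeqs n)

𝔟 : ℕ → ℕ → ℕ
𝔟 n k = count (λ ω → avoids pat120 ω ∧ allDistinct ω) (words n k)

𝔠 : ℕ → ℕ → ℕ
𝔠 n k = count (λ ω → avoids pat120 ω ∧ nonzeroDistinct ω) (words n k)

-- Σ_{i=a}^{b} f i  (empty if b < a)
sumFromTo : ℕ → ℕ → (ℕ → ℕ) → ℕ
sumFromTo a b f = sum (applyUpTo (λ i → f (a + i)) (suc b ∸ a))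

-- An inversion sequence σ avoiding 011 starts with 0 and repeats no nonzero letter, so its
-- maximum m > 0 occurs exactly once, at some position p ≥ m + 1; write σ = s · m · t with
-- |s| = p − 1. Avoiding 120 (with s before m) and avoiding repetitions force every letter of t
-- to lie strictly between max s and m, except that 0 is allowed in t when max s = 0. So either
-- max s = 0 and t is one of the words counted by 𝔠(n − p, m), or max s = j ∈ [1, m − 1], s is
-- counted by 𝔞(p − 1, j) and t shifted down by j + 1 is counted by 𝔟(n − p, m − j − 1); max s = m
-- is impossible. The inversion-sequence bounds on t hold automatically because m ≤ p − 1.

module Submission where

open import Defs
open import Data.Nat using (ℕ; zero; suc; _+_; _*_; _∸_; _≤_; _<_; _<ᵇ_; _≡ᵇ_; _⊔_; z≤n; s≤s; _≟_; _<?_)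
open import Data.Nat.Properties
open import Data.Nat.ListAction using (sum)
open import Data.Nat.ListAction.Properties using (sum-++)
open import Data.Bool using (Bool; true; false; _∧_; _∨_; not; T; if_then_else_)
open import Data.Bool.Properties using (T?; T-≡; T-∧; T-∨; ∧-zeroʳ; ∧-identityʳ; ∧-assoc; ∨-identityʳ; ∨-assoc)
open import Data.Bool.ListAction using (all; any)
open import Data.List using (List; []; _∷_; _++_; map; length; concatMap; applyUpTo; zip)
open import Data.List.Properties using (map-++; ++-assoc; ++-identityʳ; map-id; length-++; map-∘; map-applyUpTo)
open import Data.List.Relation.Unary.Any using (here; there)
import Data.List.Relation.Unary.All as All
open import Data.List.Relation.Unary.Any.Properties using (any⁺; any⁻)
open import Data.List.Relation.Unary.All.Properties using (all⁺; all⁻)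
open import Data.List.Membership.Propositional using (_∈_; _∉_; find; lose)
open import Data.List.Membership.Propositional.Properties using (∈-++⁺ˡ; ∈-++⁺ʳ; ∈-++⁻)
open import Data.Product using (∃; _×_; _,_; proj₁; proj₂)
open import Data.Sum using (_⊎_; inj₁; inj₂; [_,_]; map₁)
open import Data.Empty using (⊥; ⊥-elim)
open import Function using (_∘_; Equivalence)
open import Relation.Nullary using (¬_; yes; no)
open import Relation.Binary.Definitions using (tri<; tri≈; tri>)
open import Relation.Binary.PropositionalEquality using (_≡_; _≢_; refl; sym; trans; cong; cong₂; subst; module ≡-Reasoning)

open Equivalence using (to; from)
open import Algebra.Properties.CommutativeSemigroup +-commutativeSemigroup using (interchange)

𝟙 : Bool → ℕ
𝟙 true = 1
𝟙 false = 0

𝟙-∧ : ∀ a b → 𝟙 (a ∧ b) ≡ 𝟙 a * 𝟙 b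
𝟙-∧ true b = sym (+-identityʳ (𝟙 b))
𝟙-∧ false b = refl

T-ext : ∀ {a b} → (T a → T b) → (T b → T a) → a ≡ b
T-ext {true} {true} _ _ = refl
T-ext {true} {false} f _ = ⊥-elim (f _)
T-ext {false} {true} _ g = ⊥-elim (g _)
T-ext {false} {false} _ _ = refl

T-not⁻ : ∀ {a} → T (not a) → ¬ T a
T-not⁻ {false} _ ()

T-not⁺ : ∀ {a} → ¬ T a → T (not a)
T-not⁺ {true} ¬a = ¬a _
T-not⁺ {false} _ = _

≢⇒≡ᵇ-false : ∀ {m n} → m ≢ n → (m ≡ᵇ n) ≡ false
≢⇒≡ᵇ-false {m} {n} m≢n = T-ext (m≢n ∘ ≡ᵇ⇒≡ m n) λ ()

≡ᵇ-refl : ∀ m → (m ≡ᵇ m) ≡ true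
≡ᵇ-refl m = to T-≡ (≡⇒≡ᵇ m m refl)

≡ᵇ-comm : ∀ x y → (x ≡ᵇ y) ≡ (y ≡ᵇ x)
≡ᵇ-comm x y = T-ext (λ t → ≡⇒≡ᵇ y x (sym (≡ᵇ⇒≡ x y t))) (λ t → ≡⇒≡ᵇ x y (sym (≡ᵇ⇒≡ y x t)))

≡ᵇ-+ˡ : ∀ a x y → (a + x ≡ᵇ a + y) ≡ (x ≡ᵇ y)
≡ᵇ-+ˡ zero x y = refl
≡ᵇ-+ˡ (suc a) x y = ≡ᵇ-+ˡ a x y

∑< : ℕ → (ℕ → ℕ) → ℕ
∑< zero f = 0
∑< (suc n) f = ∑< n f + f n

∑<-cong : ∀ n {f g} → (∀ i → i < n → f i ≡ g i) → ∑< n f ≡ ∑< n g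
∑<-cong zero eq = refl
∑<-cong (suc n) eq = cong₂ _+_ (∑<-cong n (λ i i<n → eq i (m<n⇒m<1+n i<n))) (eq n (n<1+n n))

∑<-zero : ∀ n {f} → (∀ i → i < n → f i ≡ 0) → ∑< n f ≡ 0
∑<-zero zero eq = refl
∑<-zero (suc n) eq = cong₂ _+_ (∑<-zero n (λ i i<n → eq i (m<n⇒m<1+n i<n))) (eq n (n<1+n n))

∑<-sucˡ : ∀ n (f : ℕ → ℕ) → ∑< (suc n) f ≡ f 0 + ∑< n (f ∘ suc)
∑<-sucˡ zero f = +-comm 0 (f 0)
∑<-sucˡ (suc n) f = begin
  ∑< (suc n) f + f (suc n)          ≡⟨ cong (_+ f (suc n)) (∑<-sucˡ n f) ⟩
  f 0 + ∑< n (f ∘ suc) + f (suc n)  ≡⟨ +-assoc (f 0) _ _ ⟩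
  f 0 + ∑< (suc n) (f ∘ suc)        ∎
  where open ≡-Reasoning

∑<-distrib-+ : ∀ n (f g : ℕ → ℕ) → ∑< n (λ i → f i + g i) ≡ ∑< n f + ∑< n g
∑<-distrib-+ zero f g = refl
∑<-distrib-+ (suc n) f g = begin
  ∑< n (λ i → f i + g i) + (f n + g n)  ≡⟨ cong (_+ (f n + g n)) (∑<-distrib-+ n f g) ⟩
  ∑< n f + ∑< n g + (f n + g n)         ≡⟨ interchange (∑< n f) (∑< n g) (f n) (g n) ⟩
  ∑< n f + f n + (∑< n g + g n)         ∎
  where open ≡-Reasoning

∑<-*ˡ : ∀ n c (f : ℕ → ℕ) → ∑< n (λ i → c * f i) ≡ c * ∑< n f
∑<-*ˡ zero c f = sym (*-zeroʳ c)
∑<-*ˡ (suc n) c f = trans (cong (_+ c * f n) (∑<-*ˡ n c f)) (sym (*-distribˡ-+ c (∑< n f) (f n)))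

∑<-+ : ∀ a b (f : ℕ → ℕ) → ∑< (a + b) f ≡ ∑< a f + ∑< b (λ i → f (a + i))
∑<-+ a zero f = trans (cong (λ k → ∑< k f) (+-identityʳ a)) (sym (+-identityʳ _))
∑<-+ a (suc b) f = begin
  ∑< (a + suc b) f                              ≡⟨ cong (λ k → ∑< k f) (+-suc a b) ⟩
  ∑< (a + b) f + f (a + b)                      ≡⟨ cong (_+ f (a + b)) (∑<-+ a b f) ⟩
  ∑< a f + ∑< b (λ i → f (a + i)) + f (a + b)   ≡⟨ +-assoc (∑< a f) _ _ ⟩
  ∑< a f + ∑< (suc b) (λ i → f (a + i))         ∎
  where open ≡-Reasoning

∑<-δ : ∀ n c (w : ℕ → ℕ) → c < n → ∑< n (λ i → 𝟙 (c ≡ᵇ i) * w i) ≡ w c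
∑<-δ (suc n) c w c<1+n with m≤n⇒m<n∨m≡n (≤-pred c<1+n)
... | inj₁ c<n = begin
  ∑< n (λ i → 𝟙 (c ≡ᵇ i) * w i) + 𝟙 (c ≡ᵇ n) * w n  ≡⟨ cong₂ _+_ (∑<-δ n c w c<n) (cong (λ b → 𝟙 b * w n) (≢⇒≡ᵇ-false (<⇒≢ c<n))) ⟩
  w c + 0                                            ≡⟨ +-identityʳ (w c) ⟩
  w c                                                ∎
  where open ≡-Reasoning
... | inj₂ refl = begin
  ∑< c (λ i → 𝟙 (c ≡ᵇ i) * w i) + 𝟙 (c ≡ᵇ c) * w c  ≡⟨ cong₂ _+_ (∑<-zero c (λ i i<c → cong (λ b → 𝟙 b * w i) (≢⇒≡ᵇ-false (>⇒≢ i<c))))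
                                                                 (cong (λ b → 𝟙 b * w c) (≡ᵇ-refl c)) ⟩
  0 + 1 * w c                                        ≡⟨ *-identityˡ (w c) ⟩
  w c                                                ∎
  where open ≡-Reasoning

sum-applyUpTo : ∀ n (f : ℕ → ℕ) → sum (applyUpTo f n) ≡ ∑< n f
sum-applyUpTo zero f = refl
sum-applyUpTo (suc n) f = trans (cong (f 0 +_) (sum-applyUpTo n (f ∘ suc))) (sym (∑<-sucˡ n f))

sumFromTo≡∑< : ∀ a b (f : ℕ → ℕ) → sumFromTo a b f ≡ ∑< (suc b ∸ a) (λ i → f (a + i))
sumFromTo≡∑< a b f = sum-applyUpTo (suc b ∸ a) (λ i → f (a + i))

sumFromTo-cong : ∀ a b {f g : ℕ → ℕ} → (∀ i → a ≤ i → i ≤ b → f i ≡ g i) → sumFromTo a b f ≡ sumFromTo a b g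
sumFromTo-cong a b {f} {g} eq = begin
  sumFromTo a b f                    ≡⟨ sumFromTo≡∑< a b f ⟩
  ∑< (suc b ∸ a) (λ i → f (a + i))  ≡⟨ ∑<-cong (suc b ∸ a) (λ i i< → eq (a + i) (m≤m+n a i) (+-bound a b i i<)) ⟩
  ∑< (suc b ∸ a) (λ i → g (a + i))  ≡⟨ sumFromTo≡∑< a b g ⟨
  sumFromTo a b g                    ∎
  where
  open ≡-Reasoning
  +-bound : ∀ a b i → i < suc b ∸ a → a + i ≤ b
  +-bound zero b i i< = ≤-pred i<
  +-bound (suc a) zero i i< with () ← subst (i <_) (0∸n≡0 a) i<
  +-bound (suc a) (suc b) i i< = s≤s (+-bound a b i i<)

-- Sums over the sequences (s₁,…,sₙ) with sᵢ < b i, in the order of seqsBounded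

∑seq : (ℕ → ℕ) → ℕ → (List ℕ → ℕ) → ℕ
∑seq b zero f = f []
∑seq b (suc n) f = ∑seq b n (λ s → ∑< (b (suc n)) (λ v → f (s ++ v ∷ [])))

data Bounded (b : ℕ → ℕ) : ℕ → List ℕ → Set where
  [] : Bounded b 0 []
  snoc : ∀ {n s v} → Bounded b n s → v < b (suc n) → Bounded b (suc n) (s ++ v ∷ [])

∑seq-cong-bounded : ∀ b n {f g} → (∀ s → Bounded b n s → f s ≡ g s) → ∑seq b n f ≡ ∑seq b n g
∑seq-cong-bounded b zero eq = eq [] []
∑seq-cong-bounded b (suc n) eq =
  ∑seq-cong-bounded b n (λ s bs → ∑<-cong (b (suc n)) (λ v v< → eq (s ++ v ∷ []) (snoc bs v<)))

∑seq-cong : ∀ b n {f g} → (∀ s → f s ≡ g s) → ∑seq b n f ≡ ∑seq b n g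
∑seq-cong b n eq = ∑seq-cong-bounded b n (λ s _ → eq s)

∑seq-distrib-+ : ∀ b n f g → ∑seq b n (λ s → f s + g s) ≡ ∑seq b n f + ∑seq b n g
∑seq-distrib-+ b zero f g = refl
∑seq-distrib-+ b (suc n) f g =
  trans (∑seq-cong b n (λ s → ∑<-distrib-+ (b (suc n)) _ _)) (∑seq-distrib-+ b n _ _)

∑seq-*ˡ : ∀ b n c f → ∑seq b n (λ s → c * f s) ≡ c * ∑seq b n f
∑seq-*ˡ b zero c f = refl
∑seq-*ˡ b (suc n) c f = trans (∑seq-cong b n (λ s → ∑<-*ˡ (b (suc n)) c _)) (∑seq-*ˡ b n c _)

∑seq-*ʳ : ∀ b n c f → ∑seq b n (λ s → f s * c) ≡ ∑seq b n f * c
∑seq-*ʳ b n c f = trans (∑seq-cong b n (λ s → *-comm (f s) c)) (trans (∑seq-*ˡ b n c f) (*-comm c _))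

∑seq-∑< : ∀ b n k (f : ℕ → List ℕ → ℕ) → ∑seq b n (λ s → ∑< k (λ i → f i s)) ≡ ∑< k (λ i → ∑seq b n (f i))
∑seq-∑< b n zero f = ∑seq-zero n
  where
  ∑seq-zero : ∀ n → ∑seq b n (λ _ → 0) ≡ 0
  ∑seq-zero zero = refl
  ∑seq-zero (suc n) = trans (∑seq-cong b n (λ s → ∑<-zero (b (suc n)) (λ _ _ → refl))) (∑seq-zero n)
∑seq-∑< b n (suc k) f = trans (∑seq-distrib-+ b n _ _) (cong (_+ ∑seq b n (f k)) (∑seq-∑< b n k f))

∑seq-sumFromTo : ∀ b n x y (f : ℕ → List ℕ → ℕ) → ∑seq b n (λ s → sumFromTo x y (λ p → f p s)) ≡ sumFromTo x y (λ p → ∑seq b n (f p))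
∑seq-sumFromTo b n x y f = begin
  ∑seq b n (λ s → sumFromTo x y (λ p → f p s))          ≡⟨ ∑seq-cong b n (λ s → sumFromTo≡∑< x y (λ p → f p s)) ⟩
  ∑seq b n (λ s → ∑< (suc y ∸ x) (λ i → f (x + i) s))  ≡⟨ ∑seq-∑< b n (suc y ∸ x) (λ i → f (x + i)) ⟩
  ∑< (suc y ∸ x) (λ i → ∑seq b n (f (x + i)))          ≡⟨ sumFromTo≡∑< x y (λ p → ∑seq b n (f p)) ⟨
  sumFromTo x y (λ p → ∑seq b n (f p))                   ∎
  where open ≡-Reasoning

∑seq-++ : ∀ b n k f → ∑seq b (n + k) f ≡ ∑seq b n (λ s → ∑seq (λ i → b (n + i)) k (λ t → f (s ++ t)))
∑seq-++ b n zero f =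
  trans (cong (λ l → ∑seq b l f) (+-identityʳ n)) (∑seq-cong b n (λ s → cong f (sym (++-identityʳ s))))
∑seq-++ b n (suc k) f = begin
  ∑seq b (n + suc k) f
    ≡⟨ cong (λ l → ∑seq b l f) (+-suc n k) ⟩
  ∑seq b (n + k) (λ s → ∑< (b (suc (n + k))) (λ v → f (s ++ v ∷ [])))
    ≡⟨ ∑seq-++ b n k _ ⟩
  ∑seq b n (λ s → ∑seq b' k (λ t → ∑< (b (suc (n + k))) (λ v → f ((s ++ t) ++ v ∷ []))))
    ≡⟨ ∑seq-cong b n (λ s → ∑seq-cong b' k (λ t → reassociate s t)) ⟩
  ∑seq b n (λ s → ∑seq b' (suc k) (λ t → f (s ++ t)))
    ∎
  where
  open ≡-Reasoning
  b' : ℕ → ℕ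
  b' i = b (n + i)
  reassociate : ∀ s t → ∑< (b (suc (n + k))) (λ v → f ((s ++ t) ++ v ∷ [])) ≡ ∑< (b' (suc k)) (λ v → f (s ++ t ++ v ∷ []))
  reassociate s t = trans (cong (λ l → ∑< (b l) (λ v → f ((s ++ t) ++ v ∷ []))) (sym (+-suc n k)))
                          (∑<-cong (b' (suc k)) (λ v _ → cong f (++-assoc s t (v ∷ []))))

all-∷ʳ : ∀ (Q : ℕ → Bool) s v → all Q (s ++ v ∷ []) ≡ all Q s ∧ Q v
all-∷ʳ Q [] v = ∧-identityʳ (Q v)
all-∷ʳ Q (x ∷ s) v = trans (cong (Q x ∧_) (all-∷ʳ Q s v)) (sym (∧-assoc (Q x) _ _))

-- The hypothesis says that at every position h enumerates exactly the letters allowed by Q.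
∑seq-reindex : ∀ (b b' : ℕ → ℕ) (Q : ℕ → Bool) (h : ℕ → ℕ) →
  (∀ i (g : ℕ → ℕ) → ∑< (b i) (λ v → 𝟙 (Q v) * g v) ≡ ∑< (b' i) (g ∘ h)) →
  ∀ k (F : List ℕ → ℕ) → ∑seq b k (λ t → 𝟙 (all Q t) * F t) ≡ ∑seq b' k (F ∘ map h)
∑seq-reindex b b' Q h hyp zero F = +-identityʳ (F [])
∑seq-reindex b b' Q h hyp (suc k) F = begin
  ∑seq b k (λ s → ∑< (b (suc k)) (λ v → 𝟙 (all Q (s ++ v ∷ [])) * F (s ++ v ∷ [])))
    ≡⟨ ∑seq-cong b k (λ s → trans (∑<-cong (b (suc k)) (λ v _ → split-𝟙 s v)) (∑<-*ˡ (b (suc k)) (𝟙 (all Q s)) _)) ⟩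
  ∑seq b k (λ s → 𝟙 (all Q s) * ∑< (b (suc k)) (λ v → 𝟙 (Q v) * F (s ++ v ∷ [])))
    ≡⟨ ∑seq-reindex b b' Q h hyp k _ ⟩
  ∑seq b' k (λ u → ∑< (b (suc k)) (λ v → 𝟙 (Q v) * F (map h u ++ v ∷ [])))
    ≡⟨ ∑seq-cong b' k (λ u → trans (hyp (suc k) _) (∑<-cong (b' (suc k)) (λ w _ → cong F (sym (map-++ h u (w ∷ [])))))) ⟩
  ∑seq b' k (λ u → ∑< (b' (suc k)) (λ w → F (map h (u ++ w ∷ []))))
    ∎
  where
  open ≡-Reasoning
  split-𝟙 : ∀ s v → 𝟙 (all Q (s ++ v ∷ [])) * F (s ++ v ∷ []) ≡ 𝟙 (all Q s) * (𝟙 (Q v) * F (s ++ v ∷ []))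
  split-𝟙 s v = begin
    𝟙 (all Q (s ++ v ∷ [])) * F (s ++ v ∷ [])       ≡⟨ cong (λ a → 𝟙 a * F (s ++ v ∷ [])) (all-∷ʳ Q s v) ⟩
    𝟙 (all Q s ∧ Q v) * F (s ++ v ∷ [])             ≡⟨ cong (_* F (s ++ v ∷ [])) (𝟙-∧ (all Q s) (Q v)) ⟩
    𝟙 (all Q s) * 𝟙 (Q v) * F (s ++ v ∷ [])         ≡⟨ *-assoc (𝟙 (all Q s)) _ _ ⟩
    𝟙 (all Q s) * (𝟙 (Q v) * F (s ++ v ∷ []))       ∎

∑seq≡sum : ∀ b n f → ∑seq b n f ≡ sum (map f (seqsBounded b n))
∑seq≡sum b zero f = sym (+-identityʳ (f []))
∑seq≡sum b (suc n) f = begin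
  ∑seq b n (λ s → ∑< (b (suc n)) (λ v → f (s ++ v ∷ [])))
    ≡⟨ ∑seq≡sum b n _ ⟩
  sum (map (λ s → ∑< (b (suc n)) (λ v → f (s ++ v ∷ []))) (seqsBounded b n))
    ≡⟨ sum-map-concatMap (seqsBounded b n) ⟨
  sum (map f (seqsBounded b (suc n)))
    ∎
  where
  open ≡-Reasoning
  extend : List ℕ → List (List ℕ)
  extend s = map (λ v → s ++ v ∷ []) (applyUpTo (λ v → v) (b (suc n)))
  sum-extend : ∀ s → sum (map f (extend s)) ≡ ∑< (b (suc n)) (λ v → f (s ++ v ∷ []))
  sum-extend s = begin
    sum (map f (extend s))                                 ≡⟨ cong sum (map-∘ (applyUpTo (λ v → v) (b (suc n)))) ⟨
    sum (map (λ v → f (s ++ v ∷ [])) (applyUpTo (λ v → v) (b (suc n))))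
                                                           ≡⟨ cong sum (map-applyUpTo (λ v → v) (λ v → f (s ++ v ∷ [])) (b (suc n))) ⟩
    sum (applyUpTo (λ v → f (s ++ v ∷ [])) (b (suc n)))    ≡⟨ sum-applyUpTo (b (suc n)) _ ⟩
    ∑< (b (suc n)) (λ v → f (s ++ v ∷ []))                 ∎
  sum-map-concatMap : ∀ ss → sum (map f (concatMap extend ss)) ≡ sum (map (λ s → ∑< (b (suc n)) (λ v → f (s ++ v ∷ []))) ss)
  sum-map-concatMap [] = refl
  sum-map-concatMap (s ∷ ss) = begin
    sum (map f (extend s ++ concatMap extend ss))              ≡⟨ cong sum (map-++ f (extend s) _) ⟩
    sum (map f (extend s) ++ map f (concatMap extend ss))      ≡⟨ sum-++ (map f (extend s)) _ ⟩
    sum (map f (extend s)) + sum (map f (concatMap extend ss)) ≡⟨ cong₂ _+_ (sum-extend s) (sum-map-concatMap ss) ⟩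
    _                                                          ∎

count≡∑seq : ∀ (P : List ℕ → Bool) b n → count P (seqsBounded b n) ≡ ∑seq b n (𝟙 ∘ P)
count≡∑seq P b n = trans (count≡sum (seqsBounded b n)) (sym (∑seq≡sum b n (𝟙 ∘ P)))
  where
  count≡sum : ∀ xs → count P xs ≡ sum (map (𝟙 ∘ P) xs)
  count≡sum [] = refl
  count≡sum (x ∷ xs) with P x
  ... | true = cong suc (count≡sum xs)
  ... | false = count≡sum xs

any-++ : ∀ {A : Set} (p : A → Bool) xs ys → any p (xs ++ ys) ≡ any p xs ∨ any p ys
any-++ p [] ys = refl
any-++ p (x ∷ xs) ys = trans (cong (p x ∨_) (any-++ p xs ys)) (sym (∨-assoc (p x) _ _))

any-map : ∀ {A B : Set} (p : B → Bool) (f : A → B) xs → any p (map f xs) ≡ any (p ∘ f) xs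
any-map p f [] = refl
any-map p f (x ∷ xs) = cong (p (f x) ∨_) (any-map p f xs)

pairsAny : (ℕ → ℕ → Bool) → List ℕ → Bool
pairsAny g [] = false
pairsAny g (y ∷ ys) = any (g y) ys ∨ pairsAny g ys

matches : List ℕ → ℕ → ℕ → ℕ → Bool
matches ρ x y z = orderIso ρ (x ∷ y ∷ z ∷ [])

orderIso-length : ∀ ρ xs → length ρ ≢ length xs → orderIso ρ xs ≡ false
orderIso-length [] [] ≢ = ⊥-elim (≢ refl)
orderIso-length [] (x ∷ xs) _ = refl
orderIso-length (r ∷ ρ) [] _ = refl
orderIso-length (r ∷ ρ) (x ∷ xs) ≢ rewrite orderIso-length ρ xs (≢ ∘ cong suc) = ∧-zeroʳ _

module _ (a b c : ℕ) where

  private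
    ρ : List ℕ
    ρ = a ∷ b ∷ c ∷ []

    contains-∷∷∷ : ∀ x y z zs → any (λ u → orderIso ρ (x ∷ y ∷ z ∷ u)) (subseqs zs) ≡ matches ρ x y z
    contains-∷∷∷ x y z [] = ∨-identityʳ _
    contains-∷∷∷ x y z (w ∷ ws) = begin
      any P (map (w ∷_) (subseqs ws) ++ subseqs ws)        ≡⟨ any-++ P (map (w ∷_) (subseqs ws)) (subseqs ws) ⟩
      any P (map (w ∷_) (subseqs ws)) ∨ any P (subseqs ws)  ≡⟨ cong₂ _∨_ (trans (any-map P (w ∷_) (subseqs ws)) (too-long (subseqs ws)))
                                                                         (contains-∷∷∷ x y z ws) ⟩
      false ∨ matches ρ x y z                               ∎
      where
      open ≡-Reasoning
      P : List ℕ → Bool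
      P u = orderIso ρ (x ∷ y ∷ z ∷ u)
      too-long : ∀ us → any (P ∘ (w ∷_)) us ≡ false
      too-long [] = refl
      too-long (u ∷ us) = cong₂ _∨_ (orderIso-length ρ (x ∷ y ∷ z ∷ w ∷ u) (λ ())) (too-long us)

    contains-∷∷ : ∀ x y zs → any (λ u → orderIso ρ (x ∷ y ∷ u)) (subseqs zs) ≡ any (matches ρ x y) zs
    contains-∷∷ x y [] = trans (∨-identityʳ _) (orderIso-length ρ (x ∷ y ∷ []) (λ ()))
    contains-∷∷ x y (z ∷ zs) = trans (any-++ _ (map (z ∷_) (subseqs zs)) (subseqs zs))
      (cong₂ _∨_ (trans (any-map _ (z ∷_) (subseqs zs)) (contains-∷∷∷ x y z zs)) (contains-∷∷ x y zs))

    contains-∷ : ∀ x ys → any (λ u → orderIso ρ (x ∷ u)) (subseqs ys) ≡ pairsAny (matches ρ x) ys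
    contains-∷ x [] = refl
    contains-∷ x (y ∷ ys) = trans (any-++ _ (map (y ∷_) (subseqs ys)) (subseqs ys))
      (cong₂ _∨_ (trans (any-map _ (y ∷_) (subseqs ys)) (contains-∷∷ x y ys)) (contains-∷ x ys))

  contains-cons : ∀ x xs → contains (a ∷ b ∷ c ∷ []) (x ∷ xs) ≡ pairsAny (matches (a ∷ b ∷ c ∷ []) x) xs ∨ contains (a ∷ b ∷ c ∷ []) xs
  contains-cons x xs = trans (any-++ _ (map (x ∷_) (subseqs xs)) (subseqs xs))
    (cong (_∨ _) (trans (any-map _ (x ∷_) (subseqs xs)) (contains-∷ x xs)))

  avoids-cons⁻ : ∀ x xs → T (avoids (a ∷ b ∷ c ∷ []) (x ∷ xs)) →
    ¬ T (pairsAny (matches (a ∷ b ∷ c ∷ []) x) xs) × T (avoids (a ∷ b ∷ c ∷ []) xs)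
  avoids-cons⁻ x xs t = ¬contains ∘ inj₁ , T-not⁺ (¬contains ∘ inj₂)
    where
    ¬contains : ¬ (T (pairsAny (matches (a ∷ b ∷ c ∷ []) x) xs) ⊎ T (contains (a ∷ b ∷ c ∷ []) xs))
    ¬contains = T-not⁻ t ∘ subst T (sym (contains-cons x xs)) ∘ from T-∨

  avoids-cons⁺ : ∀ x xs → ¬ T (pairsAny (matches (a ∷ b ∷ c ∷ []) x) xs) → T (avoids (a ∷ b ∷ c ∷ []) xs) →
    T (avoids (a ∷ b ∷ c ∷ []) (x ∷ xs))
  avoids-cons⁺ x xs ¬p t = T-not⁺ λ c → [ ¬p , T-not⁻ t ] (to T-∨ (subst T (contains-cons x xs) c))

contains-shift : ∀ c ρ xs → contains ρ (map (c +_) xs) ≡ contains ρ xs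
contains-shift c ρ xs = begin
  any (orderIso ρ) (subseqs (map (c +_) xs))         ≡⟨ cong (any (orderIso ρ)) (subseqs-map xs) ⟩
  any (orderIso ρ) (map (map (c +_)) (subseqs xs))   ≡⟨ any-map (orderIso ρ) (map (c +_)) (subseqs xs) ⟩
  any (orderIso ρ ∘ map (c +_)) (subseqs xs)         ≡⟨ any-cong (subseqs xs) ⟩
  any (orderIso ρ) (subseqs xs)                      ∎
  where
  open ≡-Reasoning
  subseqs-map : ∀ xs → subseqs (map (c +_) xs) ≡ map (map (c +_)) (subseqs xs)
  subseqs-map [] = refl
  subseqs-map (x ∷ xs) rewrite subseqs-map xs =
    trans (cong (_++ _) (trans (sym (map-∘ (subseqs xs))) (map-∘ (subseqs xs))))
          (sym (map-++ (map (c +_)) (map (x ∷_) (subseqs xs)) (subseqs xs)))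
  same-rel-shift : ∀ c r r' x x' → same-rel r r' (c + x) (c + x') ≡ same-rel r r' x x'
  same-rel-shift zero r r' x x' = refl
  same-rel-shift (suc c) r r' x x' = same-rel-shift c r r' x x'
  all-zip-shift : ∀ (p p' : ℕ × ℕ → Bool) → (∀ r x → p (r , c + x) ≡ p' (r , x)) → ∀ ρ xs → all p (zip ρ (map (c +_) xs)) ≡ all p' (zip ρ xs)
  all-zip-shift p p' eq [] xs = refl
  all-zip-shift p p' eq (r ∷ ρ) [] = refl
  all-zip-shift p p' eq (r ∷ ρ) (x ∷ xs) = cong₂ _∧_ (eq r x) (all-zip-shift p p' eq ρ xs)
  orderIso-shift : ∀ ρ xs → orderIso ρ (map (c +_) xs) ≡ orderIso ρ xs
  orderIso-shift [] [] = refl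
  orderIso-shift [] (x ∷ xs) = refl
  orderIso-shift (r ∷ ρ) [] = refl
  orderIso-shift (r ∷ ρ) (x ∷ xs) = cong₂ _∧_ (all-zip-shift _ _ (λ r' x' → same-rel-shift c r r' x x') ρ xs) (orderIso-shift ρ xs)
  any-cong : ∀ yss → any (orderIso ρ ∘ map (c +_)) yss ≡ any (orderIso ρ) yss
  any-cong [] = refl
  any-cong (ys ∷ yss) = cong₂ _∨_ (orderIso-shift ρ ys) (any-cong yss)

<ᵇ∧≢ᵇ : ∀ x y → ((x <ᵇ y) ∧ not (x ≡ᵇ y)) ≡ (x <ᵇ y)
<ᵇ∧≢ᵇ zero zero = refl
<ᵇ∧≢ᵇ zero (suc y) = refl
<ᵇ∧≢ᵇ (suc x) zero = refl
<ᵇ∧≢ᵇ (suc x) (suc y) = <ᵇ∧≢ᵇ x y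

≮ᵇ∧≢ᵇ : ∀ x y → (not (x <ᵇ y) ∧ not (x ≡ᵇ y)) ≡ (y <ᵇ x)
≮ᵇ∧≢ᵇ zero zero = refl
≮ᵇ∧≢ᵇ zero (suc y) = refl
≮ᵇ∧≢ᵇ (suc x) zero = refl
≮ᵇ∧≢ᵇ (suc x) (suc y) = ≮ᵇ∧≢ᵇ x y

≮ᵇ∧≡ᵇ : ∀ x y → (not (x <ᵇ y) ∧ (x ≡ᵇ y)) ≡ (x ≡ᵇ y)
≮ᵇ∧≡ᵇ zero zero = refl
≮ᵇ∧≡ᵇ zero (suc y) = refl
≮ᵇ∧≡ᵇ (suc x) zero = refl
≮ᵇ∧≡ᵇ (suc x) (suc y) = ≮ᵇ∧≡ᵇ x y

matches-120 : ∀ x y z → matches pat120 x y z ≡ (x <ᵇ y) ∧ (z <ᵇ x)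
matches-120 x y z rewrite <ᵇ∧≢ᵇ x y | ≮ᵇ∧≢ᵇ x z | ≮ᵇ∧≢ᵇ y z with x <ᵇ y in x<y | z <ᵇ x in z<x
... | false | _ = refl
... | true | false = refl
... | true | true rewrite T-ext {z <ᵇ y} _ (λ _ → <⇒<ᵇ (<-trans (<ᵇ⇒< z x (from T-≡ z<x)) (<ᵇ⇒< x y (from T-≡ x<y)))) = refl

matches-011 : ∀ x y z → matches pat011 x y z ≡ (x <ᵇ y) ∧ (y ≡ᵇ z)
matches-011 x y z rewrite <ᵇ∧≢ᵇ x y | <ᵇ∧≢ᵇ x z | ≮ᵇ∧≡ᵇ y z with x <ᵇ y in x<y | y ≡ᵇ z in y≡z
... | false | _ = refl
... | true | false = ∧-zeroʳ _
... | true | true rewrite sym (≡ᵇ⇒≡ y z (from T-≡ y≡z)) | x<y = refl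

matches-120⁻ : ∀ x y z → T (matches pat120 x y z) → x < y × z < x
matches-120⁻ x y z t with to T-∧ (subst T (matches-120 x y z) t)
... | x<y , z<x = <ᵇ⇒< x y x<y , <ᵇ⇒< z x z<x

matches-120⁺ : ∀ {x y z} → x < y → z < x → T (matches pat120 x y z)
matches-120⁺ {x} {y} {z} x<y z<x = subst T (sym (matches-120 x y z)) (from T-∧ (<⇒<ᵇ x<y , <⇒<ᵇ z<x))

matches-011⁻ : ∀ x y z → T (matches pat011 x y z) → x < y × y ≡ z
matches-011⁻ x y z t with to T-∧ (subst T (matches-011 x y z) t)
... | x<y , y≡z = <ᵇ⇒< x y x<y , ≡ᵇ⇒≡ y z y≡z

matches-011⁺ : ∀ {x y} → x < y → T (matches pat011 x y y)
matches-011⁺ {x} {y} x<y = subst T (sym (matches-011 x y y)) (from T-∧ (<⇒<ᵇ x<y , ≡⇒≡ᵇ y y refl))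

starts120 : ℕ → List ℕ → Bool
starts120 x = pairsAny (matches pat120 x)

starts120-below : ∀ {x} ys → T (starts120 x ys) → ∃ λ z → z ∈ ys × z < x
starts120-below {x} (y ∷ ys) t with to T-∨ t
... | inj₁ p = let z , z∈ys , m = find (any⁻ _ ys p) in z , there z∈ys , proj₂ (matches-120⁻ x y z m)
... | inj₂ p = let z , z∈ys , z<x = starts120-below ys p in z , there z∈ys , z<x

starts120-above : ∀ {x} ys → T (starts120 x ys) → ∃ λ y → y ∈ ys × x < y
starts120-above {x} (y ∷ ys) t with to T-∨ t
... | inj₁ p = let z , _ , m = find (any⁻ _ ys p) in y , here refl , proj₁ (matches-120⁻ x y z m)
... | inj₂ p = let z , z∈ys , x<z = starts120-above ys p in z , there z∈ys , x<z

starts120-++⁻ : ∀ {x} as bs → T (starts120 x (as ++ bs)) → T (starts120 x as) ⊎ (∃ λ z → z ∈ bs × z < x)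
starts120-++⁻ [] bs t = inj₂ (starts120-below bs t)
starts120-++⁻ {x} (a ∷ as) bs t with to T-∨ t
... | inj₂ p = map₁ (from T-∨ ∘ inj₂) (starts120-++⁻ as bs p)
... | inj₁ p with find (any⁻ _ (as ++ bs) p)
...   | z , z∈ , m with ∈-++⁻ as z∈
...     | inj₁ z∈as = inj₁ (from T-∨ (inj₁ (any⁺ _ (lose z∈as m))))
...     | inj₂ z∈bs = inj₂ (z , z∈bs , proj₂ (matches-120⁻ x a z m))

pairsAny-++⁺ : ∀ g as bs → T (pairsAny g as) → T (pairsAny g (as ++ bs))
pairsAny-++⁺ g (a ∷ as) bs t with to T-∨ t
... | inj₁ p = let _ , z∈ , m = find (any⁻ _ as p) in from T-∨ (inj₁ (any⁺ _ (lose (∈-++⁺ˡ z∈) m)))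
... | inj₂ p = from T-∨ (inj₂ (pairsAny-++⁺ g as bs p))

starts120⁺ : ∀ {x y z} cs bs → x < y → z ∈ bs → z < x → T (starts120 x (cs ++ y ∷ bs))
starts120⁺ [] bs x<y z∈bs z<x = from T-∨ (inj₁ (any⁺ _ (lose z∈bs (matches-120⁺ x<y z<x))))
starts120⁺ (c ∷ cs) bs x<y z∈bs z<x = from T-∨ (inj₂ (starts120⁺ cs bs x<y z∈bs z<x))

avoids120-++⁻ : ∀ as bs → T (avoids pat120 (as ++ bs)) → T (avoids pat120 as) × T (avoids pat120 bs)
avoids120-++⁻ [] bs t = _ , t
avoids120-++⁻ (a ∷ as) bs t =
  let ¬s , t' = avoids-cons⁻ 1 2 0 a (as ++ bs) t
      ta , tb = avoids120-++⁻ as bs t'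
  in avoids-cons⁺ 1 2 0 a as (¬s ∘ pairsAny-++⁺ _ as bs) ta , tb

avoids120-++⁺ : ∀ as bs → T (avoids pat120 as) → T (avoids pat120 bs) →
  (∀ {x z} → x ∈ as → z ∈ bs → x ≤ z) → T (avoids pat120 (as ++ bs))
avoids120-++⁺ [] bs _ tb _ = tb
avoids120-++⁺ (a ∷ as) bs ta tb below =
  let ¬s , ta' = avoids-cons⁻ 1 2 0 a as ta
  in avoids-cons⁺ 1 2 0 a (as ++ bs) ([ ¬s , (λ (z , z∈bs , z<a) → <⇒≱ z<a (below (here refl) z∈bs)) ] ∘ starts120-++⁻ as bs)
       (avoids120-++⁺ as bs ta' tb (below ∘ there))

avoids120-∷-max : ∀ m t → T (avoids pat120 t) → (∀ {z} → z ∈ t → z ≤ m) → T (avoids pat120 (m ∷ t))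
avoids120-∷-max m t at ≤m = avoids-cons⁺ 1 2 0 m t (λ s → let _ , y∈t , m<y = starts120-above t s in <⇒≱ m<y (≤m y∈t)) at

avoids120-occurrence : ∀ as {y} bs {x z} → T (avoids pat120 (as ++ y ∷ bs)) → x ∈ as → x < y → z ∈ bs → z < x → ⊥
avoids120-occurrence (a ∷ as) {y} bs t (here refl) x<y z∈bs z<x = proj₁ (avoids-cons⁻ 1 2 0 a (as ++ y ∷ bs) t) (starts120⁺ as bs x<y z∈bs z<x)
avoids120-occurrence (a ∷ as) {y} bs t (there x∈as) = avoids120-occurrence as bs (proj₂ (avoids-cons⁻ 1 2 0 a (as ++ y ∷ bs) t)) x∈as

avoids120-zeros : ∀ xs → (∀ {x} → x ∈ xs → x ≡ 0) → T (avoids pat120 xs)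
avoids120-zeros [] _ = _
avoids120-zeros (x ∷ xs) zeros with zeros (here refl)
... | refl = avoids-cons⁺ 1 2 0 0 xs (λ s → let _ , _ , z<0 = starts120-below xs s in n≮0 z<0) (avoids120-zeros xs (zeros ∘ there))

occurs-pos : ∀ {x} xs → x ∈ xs → 0 < occurs x xs
occurs-pos {x} (y ∷ xs) x∈ with y ≡ᵇ x in y≡x
... | true = s≤s z≤n
occurs-pos {x} (y ∷ xs) (here refl) | false with () ← trans (sym y≡x) (≡ᵇ-refl x)
occurs-pos {x} (y ∷ xs) (there x∈) | false = occurs-pos xs x∈

occurs≡0⁻ : ∀ x xs → T (occurs x xs ≡ᵇ 0) → x ∉ xs
occurs≡0⁻ x xs t x∈ with occurs x xs | occurs-pos xs x∈
occurs≡0⁻ x xs () x∈ | suc _ | _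

occurs≡0⁺ : ∀ x xs → x ∉ xs → T (occurs x xs ≡ᵇ 0)
occurs≡0⁺ x [] _ = _
occurs≡0⁺ x (y ∷ xs) x∉ with y ≡ᵇ x in y≡x
... | true = x∉ (here (sym (≡ᵇ⇒≡ y x (from T-≡ y≡x))))
... | false = occurs≡0⁺ x xs (x∉ ∘ there)

occurs≢0⇒∈ : ∀ x xs → ¬ T (occurs x xs ≡ᵇ 0) → x ∈ xs
occurs≢0⇒∈ x [] occ = ⊥-elim (occ _)
occurs≢0⇒∈ x (y ∷ xs) occ with y ≡ᵇ x in y≡x
... | true = here (sym (≡ᵇ⇒≡ y x (from T-≡ y≡x)))
... | false = there (occurs≢0⇒∈ x xs occ)

nonzeroDistinct-cons⁻ : ∀ x xs → T (nonzeroDistinct (x ∷ xs)) → (x ≢ 0 → x ∉ xs) × T (nonzeroDistinct xs)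
nonzeroDistinct-cons⁻ x xs t with to T-∧ t
... | head , rest = fresh , rest
  where
  fresh : x ≢ 0 → x ∉ xs
  fresh x≢0 with to T-∨ head
  ... | inj₁ x≡0 = ⊥-elim (x≢0 (≡ᵇ⇒≡ x 0 x≡0))
  ... | inj₂ occ = occurs≡0⁻ x xs occ

nonzeroDistinct-cons⁺ : ∀ x xs → (x ≢ 0 → x ∉ xs) → T (nonzeroDistinct xs) → T (nonzeroDistinct (x ∷ xs))
nonzeroDistinct-cons⁺ x xs fresh t = from T-∧ (head , t)
  where
  head : T ((x ≡ᵇ 0) ∨ (occurs x xs ≡ᵇ 0))
  head with x ≟ 0
  ... | yes x≡0 = from T-∨ (inj₁ (≡⇒≡ᵇ x 0 x≡0))
  ... | no x≢0 = from T-∨ (inj₂ (occurs≡0⁺ x xs (fresh x≢0)))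

nonzeroDistinct-++⁻ : ∀ as bs → T (nonzeroDistinct (as ++ bs)) →
  T (nonzeroDistinct as) × T (nonzeroDistinct bs) × (∀ {x} → x ∈ as → x ≢ 0 → x ∉ bs)
nonzeroDistinct-++⁻ [] bs t = _ , t , λ ()
nonzeroDistinct-++⁻ (a ∷ as) bs t =
  let fresh , t' = nonzeroDistinct-cons⁻ a (as ++ bs) t
      tas , tbs , disjoint = nonzeroDistinct-++⁻ as bs t'
  in nonzeroDistinct-cons⁺ a as (λ a≢0 → fresh a≢0 ∘ ∈-++⁺ˡ) tas , tbs ,
     λ { (here refl) a≢0 → fresh a≢0 ∘ ∈-++⁺ʳ as ; (there x∈as) → disjoint x∈as }

nonzeroDistinct-++⁺ : ∀ as bs → T (nonzeroDistinct as) → T (nonzeroDistinct bs) →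
  (∀ {x} → x ∈ as → x ≢ 0 → x ∉ bs) → T (nonzeroDistinct (as ++ bs))
nonzeroDistinct-++⁺ [] bs _ tbs _ = tbs
nonzeroDistinct-++⁺ (a ∷ as) bs tas tbs disjoint =
  let fresh , tas' = nonzeroDistinct-cons⁻ a as tas
  in nonzeroDistinct-cons⁺ a (as ++ bs) (λ a≢0 a∈ → [ fresh a≢0 , disjoint (here refl) a≢0 ] (∈-++⁻ as a∈))
       (nonzeroDistinct-++⁺ as bs tas' tbs (disjoint ∘ there))

nonzeroDistinct-zeros : ∀ xs → (∀ {x} → x ∈ xs → x ≡ 0) → T (nonzeroDistinct xs)
nonzeroDistinct-zeros [] _ = _
nonzeroDistinct-zeros (x ∷ xs) zeros =
  nonzeroDistinct-cons⁺ x xs (λ x≢0 _ → x≢0 (zeros (here refl))) (nonzeroDistinct-zeros xs (zeros ∘ there))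

allDistinct≡nonzeroDistinct : ∀ t → (∀ {x} → x ∈ t → 0 < x) → allDistinct t ≡ nonzeroDistinct t
allDistinct≡nonzeroDistinct [] _ = refl
allDistinct≡nonzeroDistinct (x ∷ t) pos with pos (here refl)
allDistinct≡nonzeroDistinct (suc x ∷ t) pos | s≤s _ = cong ((occurs (suc x) t ≡ᵇ 0) ∧_) (allDistinct≡nonzeroDistinct t (pos ∘ there))

occurs≤1 : ∀ {m} ρ → T (nonzeroDistinct ρ) → m ≢ 0 → occurs m ρ ≤ 1
occurs≤1 [] _ _ = z≤n
occurs≤1 {m} (y ∷ ys) t m≢0 with nonzeroDistinct-cons⁻ y ys t | y ≡ᵇ m in y≡m
... | _ , t' | false = occurs≤1 ys t' m≢0
... | fresh , _ | true with ≡ᵇ⇒≡ y m (from T-≡ y≡m)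
...   | refl = s≤s (≤-reflexive (≡ᵇ⇒≡ _ 0 (occurs≡0⁺ y ys (fresh m≢0))))

avoids011-0∷ : ∀ ρ → avoids pat011 (0 ∷ ρ) ≡ nonzeroDistinct ρ
avoids011-0∷ ρ = T-ext (λ t → nonzeroDistinct-from t) λ t → avoids-cons⁺ 0 1 1 0 ρ (no-start 0 ρ t) (avoids011 ρ t)
  where
  no-start : ∀ x ρ → T (nonzeroDistinct ρ) → ¬ T (pairsAny (matches pat011 x) ρ)
  no-start x (y ∷ ys) t s with nonzeroDistinct-cons⁻ y ys t | to T-∨ s
  ... | _ , t' | inj₂ s' = no-start x ys t' s'
  ... | fresh , _ | inj₁ p with find (any⁻ _ ys p)
  ...   | z , z∈ys , m with matches-011⁻ x y z m
  ...     | x<y , refl = fresh (λ y≡0 → n≮0 (subst (x <_) y≡0 x<y)) z∈ys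
  avoids011 : ∀ ρ → T (nonzeroDistinct ρ) → T (avoids pat011 ρ)
  avoids011 [] _ = _
  avoids011 (y ∷ ys) t = let _ , t' = nonzeroDistinct-cons⁻ y ys t in avoids-cons⁺ 0 1 1 y ys (no-start y ys t') (avoids011 ys t')
  repeat : ∀ ρ → ¬ T (nonzeroDistinct ρ) → T (pairsAny (matches pat011 0) ρ)
  repeat [] ¬t = ⊥-elim (¬t _)
  repeat (y ∷ ys) ¬t with T? (nonzeroDistinct ys)
  ... | no ¬t' = from T-∨ (inj₂ (repeat ys ¬t'))
  ... | yes t' with y ≟ 0 | T? (occurs y ys ≡ᵇ 0)
  ...   | yes y≡0 | _ = ⊥-elim (¬t (nonzeroDistinct-cons⁺ y ys (λ y≢0 → ⊥-elim (y≢0 y≡0)) t'))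
  ...   | no _ | yes occ = ⊥-elim (¬t (nonzeroDistinct-cons⁺ y ys (λ _ → occurs≡0⁻ y ys occ) t'))
  ...   | no y≢0 | no occ = from T-∨ (inj₁ (any⁺ _ (lose (occurs≢0⇒∈ y ys occ) (matches-011⁺ (n≢0⇒n>0 y≢0)))))
  nonzeroDistinct-from : T (avoids pat011 (0 ∷ ρ)) → T (nonzeroDistinct ρ)
  nonzeroDistinct-from t with T? (nonzeroDistinct ρ)
  ... | yes t' = t'
  ... | no ¬t' = ⊥-elim (proj₁ (avoids-cons⁻ 0 1 1 0 ρ t) (repeat ρ ¬t'))

maxL-++ : ∀ as bs → maxL (as ++ bs) ≡ maxL as ⊔ maxL bs
maxL-++ [] bs = refl
maxL-++ (a ∷ as) bs = trans (cong (a ⊔_) (maxL-++ as bs)) (sym (⊔-assoc a _ _))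

∈⇒≤maxL : ∀ {x} xs → x ∈ xs → x ≤ maxL xs
∈⇒≤maxL (y ∷ xs) (here refl) = m≤m⊔n y _
∈⇒≤maxL (y ∷ xs) (there x∈) = ≤-trans (∈⇒≤maxL xs x∈) (m≤n⊔m y _)

maxL-lub : ∀ {k} xs → (∀ {x} → x ∈ xs → x ≤ k) → maxL xs ≤ k
maxL-lub [] _ = z≤n
maxL-lub (x ∷ xs) ≤k = ⊔-lub (≤k (here refl)) (maxL-lub xs (≤k ∘ there))

maxL-attained : ∀ {m} xs → m ∈ xs → (∀ {x} → x ∈ xs → x ≤ m) → maxL xs ≡ m
maxL-attained xs m∈ ≤m = ≤-antisym (maxL-lub xs ≤m) (∈⇒≤maxL xs m∈)

maxL∈ : ∀ xs → 0 < maxL xs → maxL xs ∈ xs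
maxL∈ (x ∷ xs) pos with ⊔-sel x (maxL xs)
... | inj₁ eq rewrite eq = here refl
... | inj₂ eq rewrite eq = there (maxL∈ xs pos)

maxL≡0⇒zeros : ∀ xs → maxL xs ≡ 0 → ∀ {x} → x ∈ xs → x ≡ 0
maxL≡0⇒zeros xs max≡0 x∈ = n≤0⇒n≡0 (subst (_ ≤_) max≡0 (∈⇒≤maxL xs x∈))

IsA : ℕ → List ℕ → Bool
IsA m σ = avoids pat011 σ ∧ avoids pat120 σ ∧ (maxL σ ≡ᵇ m)

IsB IsC : List ℕ → Bool
IsB ω = avoids pat120 ω ∧ allDistinct ω
IsC ω = avoids pat120 ω ∧ nonzeroDistinct ω

IsA-0∷⁻ : ∀ {m} ρ → T (IsA m (0 ∷ ρ)) → T (nonzeroDistinct ρ) × T (avoids pat120 (0 ∷ ρ)) × maxL ρ ≡ m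
IsA-0∷⁻ {m} ρ t =
  let t011 , t' = to T-∧ t
      t120 , tmax = to T-∧ t'
  in subst T (avoids011-0∷ ρ) t011 , t120 , ≡ᵇ⇒≡ _ m tmax

IsA-0∷⁺ : ∀ {m} ρ → T (nonzeroDistinct ρ) → T (avoids pat120 (0 ∷ ρ)) → maxL ρ ≡ m → T (IsA m (0 ∷ ρ))
IsA-0∷⁺ {m} ρ nz t120 max≡m =
  from T-∧ (subst T (sym (avoids011-0∷ ρ)) nz , from T-∧ (t120 , ≡⇒≡ᵇ _ m max≡m))

-- Splitting a sequence at its maximum m

module _ (s t : List ℕ) {m : ℕ} (0<m : 0 < m) where

  private
    m≢0 : m ≢ 0
    m≢0 = >⇒≢ 0<m

    σ : List ℕ
    σ = 0 ∷ s ++ m ∷ t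

    inRange : ℕ → List ℕ → Bool
    inRange j = all (λ v → (j <ᵇ v) ∧ (v <ᵇ m))

    maxL-split : ∀ {k} → (∀ {x} → x ∈ s → x ≤ k) → k ≤ m → (∀ {z} → z ∈ t → z < m) → maxL (s ++ m ∷ t) ≡ m
    maxL-split ≤k k≤m <m = maxL-attained (s ++ m ∷ t) (∈-++⁺ʳ s (here refl)) ≤m
      where
      ≤m : ∀ {x} → x ∈ s ++ m ∷ t → x ≤ m
      ≤m x∈ with ∈-++⁻ s x∈
      ... | inj₁ x∈s = ≤-trans (≤k x∈s) k≤m
      ... | inj₂ (here refl) = ≤-refl
      ... | inj₂ (there x∈t) = <⇒≤ (<m x∈t)

    tail-facts : T (IsA m σ) → T (avoids pat120 t) × T (nonzeroDistinct t) × (∀ {z} → z ∈ t → z < m)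
    tail-facts a with IsA-0∷⁻ (s ++ m ∷ t) a
    ... | nz , av , max≡m with nonzeroDistinct-++⁻ s (m ∷ t) nz
    ...   | _ , nz-mt , _ with nonzeroDistinct-cons⁻ m t nz-mt
    ...     | m∉t , nzt = proj₂ (avoids-cons⁻ 1 2 0 m t (proj₂ (avoids120-++⁻ (0 ∷ s) (m ∷ t) av))) , nzt , z<m
      where
      z<m : ∀ {z} → z ∈ t → z < m
      z<m {z} z∈ = ≤∧≢⇒< (subst (z ≤_) max≡m (∈⇒≤maxL (s ++ m ∷ t) (∈-++⁺ʳ s (there z∈))))
                          (λ z≡m → m∉t m≢0 (subst (_∈ t) z≡m z∈))

  IsA-split-max≡0 : maxL s ≡ 0 → IsA m σ ≡ all (_<ᵇ m) t ∧ IsC t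
  IsA-split-max≡0 max≡0 = T-ext to′ from′
    where
    zeros : ∀ {x} → x ∈ 0 ∷ s → x ≡ 0
    zeros (here refl) = refl
    zeros (there x∈) = maxL≡0⇒zeros s max≡0 x∈
    to′ : T (IsA m σ) → T (all (_<ᵇ m) t ∧ IsC t)
    to′ a with tail-facts a
    ... | avt , nzt , z<m = from T-∧ (all⁻ _ (All.tabulate (<⇒<ᵇ ∘ z<m)) , from T-∧ (avt , nzt))
    from′ : T (all (_<ᵇ m) t ∧ IsC t) → T (IsA m σ)
    from′ c with to T-∧ c
    ... | bounded , isC with to T-∧ isC
    ... | avt , nzt = IsA-0∷⁺ (s ++ m ∷ t) nz av (maxL-split (≤-reflexive ∘ zeros ∘ there) z≤n z<m)
      where
      z<m : ∀ {z} → z ∈ t → z < m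
      z<m {z} = <ᵇ⇒< z m ∘ All.lookup (all⁺ _ t bounded)
      nz : T (nonzeroDistinct (s ++ m ∷ t))
      nz = nonzeroDistinct-++⁺ s (m ∷ t) (nonzeroDistinct-zeros s (zeros ∘ there))
             (nonzeroDistinct-cons⁺ m t (λ _ → <-irrefl refl ∘ z<m) nzt) (λ x∈ x≢0 _ → x≢0 (zeros (there x∈)))
      av : T (avoids pat120 σ)
      av = avoids120-++⁺ (0 ∷ s) (m ∷ t) (avoids120-zeros (0 ∷ s) zeros) (avoids120-∷-max m t avt (<⇒≤ ∘ z<m))
             (λ x∈ _ → subst (_≤ _) (sym (zeros x∈)) z≤n)

  private
    module _ (pos : 0 < maxL s) (j<m : maxL s < m) where
      j : ℕ
      j = maxL s

      x≤j : ∀ {x} → x ∈ 0 ∷ s → x ≤ j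
      x≤j (here refl) = z≤n
      x≤j (there x∈) = ∈⇒≤maxL s x∈

      IsA-split-max<⁻ : T (IsA m σ) → T (IsA j (0 ∷ s) ∧ (inRange j t ∧ IsB t))
      IsA-split-max<⁻ a with IsA-0∷⁻ (s ++ m ∷ t) a | tail-facts a
      ... | nz , av , _ | avt , nzt , z<m with nonzeroDistinct-++⁻ s (m ∷ t) nz | avoids120-++⁻ (0 ∷ s) (m ∷ t) av
      ...   | nzs , _ , disjoint | av0s , _ =
        from T-∧ (IsA-0∷⁺ s nzs av0s refl , from T-∧ (all⁻ _ (All.tabulate between) , from T-∧ (avt , subst T (sym adt) nzt)))
        where
        -- a tail letter equal to j repeats it, one below j completes a 120 with j and m
        j<z : ∀ {z} → z ∈ t → j < z
        j<z {z} z∈ with <-cmp j z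
        ... | tri< j<z _ _ = j<z
        ... | tri≈ _ j≡z _ = ⊥-elim (disjoint (maxL∈ s pos) (>⇒≢ pos) (there (subst (_∈ t) (sym j≡z) z∈)))
        ... | tri> _ _ z<j = ⊥-elim (avoids120-occurrence (0 ∷ s) t av (there (maxL∈ s pos)) j<m z∈ z<j)
        between : ∀ {z} → z ∈ t → T ((j <ᵇ z) ∧ (z <ᵇ m))
        between z∈ = from T-∧ (<⇒<ᵇ (j<z z∈) , <⇒<ᵇ (z<m z∈))
        adt : allDistinct t ≡ nonzeroDistinct t
        adt = allDistinct≡nonzeroDistinct t (λ z∈ → <-trans pos (j<z z∈))

      IsA-split-max<⁺ : T (IsA j (0 ∷ s) ∧ (inRange j t ∧ IsB t)) → T (IsA m σ)
      IsA-split-max<⁺ c with to T-∧ c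
      ... | isA , rest with to T-∧ rest
      ... | bounded , isB with to T-∧ isB | IsA-0∷⁻ s isA
      ... | avt , adt | nzs , av0s , _ = IsA-0∷⁺ (s ++ m ∷ t) nz av (maxL-split (x≤j ∘ there) (<⇒≤ j<m) (proj₂ ∘ between))
        where
        between : ∀ {z} → z ∈ t → j < z × z < m
        between {z} z∈ = let j<z , z<m = to T-∧ (All.lookup (all⁺ _ t bounded) z∈) in <ᵇ⇒< j z j<z , <ᵇ⇒< z m z<m
        above : ∀ {y} → y ∈ m ∷ t → j < y
        above (here refl) = j<m
        above (there y∈) = proj₁ (between y∈)
        nzt : T (nonzeroDistinct t)
        nzt = subst T (allDistinct≡nonzeroDistinct t (λ z∈ → <-trans pos (proj₁ (between z∈)))) adt
        nz : T (nonzeroDistinct (s ++ m ∷ t))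
        nz = nonzeroDistinct-++⁺ s (m ∷ t) nzs (nonzeroDistinct-cons⁺ m t (λ _ m∈ → <-irrefl refl (proj₂ (between m∈))) nzt)
               (λ x∈ _ x∈' → <⇒≱ (above x∈') (x≤j (there x∈)))
        av : T (avoids pat120 σ)
        av = avoids120-++⁺ (0 ∷ s) (m ∷ t) av0s (avoids120-∷-max m t avt (<⇒≤ ∘ proj₂ ∘ between))
               (λ x∈ y∈ → ≤-trans (x≤j x∈) (<⇒≤ (above y∈)))

  IsA-split-max< : (pos : 0 < maxL s) → maxL s < m → IsA m σ ≡ IsA (maxL s) (0 ∷ s) ∧ (inRange (maxL s) t ∧ IsB t)
  IsA-split-max< pos j<m = T-ext (IsA-split-max<⁻ pos j<m) (IsA-split-max<⁺ pos j<m)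

  IsA-split-max≥ : 0 < maxL s → m ≤ maxL s → IsA m σ ≡ false
  IsA-split-max≥ pos m≤j = T-ext to′ λ ()
    where
    to′ : T (IsA m σ) → T false
    to′ a with IsA-0∷⁻ (s ++ m ∷ t) a
    ... | nz , _ , max≡m = proj₂ (proj₂ (nonzeroDistinct-++⁻ s (m ∷ t) nz)) (maxL∈ s pos) (>⇒≢ pos) (here j≡m)
      where
      j≡m : maxL s ≡ m
      j≡m = ≤-antisym (subst (_ ≤_) max≡m (∈⇒≤maxL (s ++ m ∷ t) (∈-++⁺ˡ (maxL∈ s pos)))) m≤j

sumFromTo-zero : ∀ a b {f : ℕ → ℕ} → (∀ i → a ≤ i → i ≤ b → f i ≡ 0) → sumFromTo a b f ≡ 0
sumFromTo-zero a b {f} eq = trans (sumFromTo-cong a b eq) (trans (sumFromTo≡∑< a b (λ _ → 0)) (∑<-zero (suc b ∸ a) (λ _ _ → refl)))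

sumFromTo-δ : ∀ a b c (w : ℕ → ℕ) → a ≤ c → c ≤ b → sumFromTo a b (λ i → 𝟙 (c ≡ᵇ i) * w i) ≡ w c
sumFromTo-δ a b c w a≤c c≤b = begin
  sumFromTo a b (λ i → 𝟙 (c ≡ᵇ i) * w i)               ≡⟨ sumFromTo≡∑< a b (λ i → 𝟙 (c ≡ᵇ i) * w i) ⟩
  ∑< (suc b ∸ a) (λ i → 𝟙 (c ≡ᵇ a + i) * w (a + i))    ≡⟨ ∑<-cong (suc b ∸ a) (λ i _ → cong (λ e → 𝟙 e * w (a + i)) (shift i)) ⟩
  ∑< (suc b ∸ a) (λ i → 𝟙 (c ∸ a ≡ᵇ i) * w (a + i))    ≡⟨ ∑<-δ (suc b ∸ a) (c ∸ a) (w ∘ (a +_)) (∸-monoˡ-< (s≤s c≤b) a≤c) ⟩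
  w (a + (c ∸ a))                                       ≡⟨ cong w (m+[n∸m]≡n a≤c) ⟩
  w c                                                   ∎
  where
  open ≡-Reasoning
  shift : ∀ i → (c ≡ᵇ a + i) ≡ (c ∸ a ≡ᵇ i)
  shift i = trans (cong (_≡ᵇ a + i) (sym (m+[n∸m]≡n a≤c))) (≡ᵇ-+ˡ a (c ∸ a) i)

𝟙-IsA : ∀ j σ → 𝟙 (IsA j σ) ≡ 𝟙 (maxL σ ≡ᵇ j) * 𝟙 (IsA (maxL σ) σ)
𝟙-IsA j σ rewrite ≡ᵇ-refl (maxL σ) with avoids pat011 σ | avoids pat120 σ | maxL σ ≡ᵇ j
... | a | b | true = sym (+-identityʳ _)
... | a | b | false = ∧-zeroʳ-𝟙 a b
  where
  ∧-zeroʳ-𝟙 : ∀ a b → 𝟙 (a ∧ b ∧ false) ≡ 0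
  ∧-zeroʳ-𝟙 a b = cong 𝟙 (trans (cong (a ∧_) (∧-zeroʳ b)) (∧-zeroʳ a))

sumFromTo-IsA-∉ : ∀ σ a b (w : ℕ → ℕ) → (∀ j → a ≤ j → j ≤ b → maxL σ ≢ j) → sumFromTo a b (λ j → 𝟙 (IsA j σ) * w j) ≡ 0
sumFromTo-IsA-∉ σ a b w ∉ = sumFromTo-zero a b λ j a≤j j≤b →
  cong (_* w j) (trans (𝟙-IsA j σ) (cong (λ e → 𝟙 e * 𝟙 (IsA (maxL σ) σ)) (≢⇒≡ᵇ-false (∉ j a≤j j≤b))))

sumFromTo-IsA-∈ : ∀ σ a b (w : ℕ → ℕ) → a ≤ maxL σ → maxL σ ≤ b → sumFromTo a b (λ j → 𝟙 (IsA j σ) * w j) ≡ 𝟙 (IsA (maxL σ) σ) * w (maxL σ)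
sumFromTo-IsA-∈ σ a b w a≤ ≤b = begin
  sumFromTo a b (λ j → 𝟙 (IsA j σ) * w j)                    ≡⟨ sumFromTo-cong a b (λ j _ _ → trans (cong (_* w j) (𝟙-IsA j σ)) (*-assoc (𝟙 (maxL σ ≡ᵇ j)) _ _)) ⟩
  sumFromTo a b (λ j → 𝟙 (maxL σ ≡ᵇ j) * (𝟙 (IsA (maxL σ) σ) * w j))
                                                              ≡⟨ sumFromTo-δ a b (maxL σ) (λ j → 𝟙 (IsA (maxL σ) σ) * w j) a≤ ≤b ⟩
  𝟙 (IsA (maxL σ) σ) * w (maxL σ)                            ∎
  where open ≡-Reasoning

cWeight : ℕ → List ℕ → ℕ
cWeight m t = 𝟙 (all (_<ᵇ m) t) * 𝟙 (IsC t)

bWeight : ℕ → ℕ → List ℕ → ℕ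
bWeight m j t = 𝟙 (all (λ v → (j <ᵇ v) ∧ (v <ᵇ m)) t) * 𝟙 (IsB t)

<⇒≤∸1 : ∀ {j m} → j < m → j ≤ m ∸ 1
<⇒≤∸1 (s≤s j≤m) = j≤m

≤∸1⇒< : ∀ {j m} → 0 < m → j ≤ m ∸ 1 → j < m
≤∸1⇒< {m = suc m} _ j≤m = s≤s j≤m

𝟙-IsA-split : ∀ s t {m} → 0 < m →
  𝟙 (IsA m (0 ∷ s ++ m ∷ t)) ≡ 𝟙 (maxL s ≡ᵇ 0) * cWeight m t + sumFromTo 1 (m ∸ 1) (λ j → 𝟙 (IsA j (0 ∷ s)) * bWeight m j t)
𝟙-IsA-split s t {m} 0<m with maxL s ≟ 0 | maxL s <? m
... | yes max≡0 | _ = begin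
  𝟙 (IsA m (0 ∷ s ++ m ∷ t))            ≡⟨ cong 𝟙 (IsA-split-max≡0 s t 0<m max≡0) ⟩
  𝟙 (all (_<ᵇ m) t ∧ IsC t)             ≡⟨ 𝟙-∧ (all (_<ᵇ m) t) (IsC t) ⟩
  cWeight m t                            ≡⟨ trans (+-identityʳ (1 * cWeight m t)) (*-identityˡ (cWeight m t)) ⟨
  1 * cWeight m t + 0                    ≡⟨ cong₂ (λ e x → 𝟙 e * cWeight m t + x) (sym (trans (cong (_≡ᵇ 0) max≡0) (≡ᵇ-refl 0)))
                                                    (sym (sumFromTo-IsA-∉ (0 ∷ s) 1 (m ∸ 1) (λ j → bWeight m j t) λ j 1≤j _ max≡j → <⇒≢ 1≤j (trans (sym max≡0) max≡j))) ⟩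
  𝟙 (maxL s ≡ᵇ 0) * cWeight m t + Σb    ∎
  where
  open ≡-Reasoning
  Σb : ℕ
  Σb = sumFromTo 1 (m ∸ 1) (λ j → 𝟙 (IsA j (0 ∷ s)) * bWeight m j t)
... | no max≢0 | yes max<m = begin
  𝟙 (IsA m (0 ∷ s ++ m ∷ t))                                     ≡⟨ cong 𝟙 (IsA-split-max< s t 0<m (n≢0⇒n>0 max≢0) max<m) ⟩
  𝟙 (IsA (maxL s) (0 ∷ s) ∧ (all inRange t ∧ IsB t))              ≡⟨ trans (𝟙-∧ (IsA (maxL s) (0 ∷ s)) _) (cong (𝟙 (IsA (maxL s) (0 ∷ s)) *_) (𝟙-∧ (all inRange t) (IsB t))) ⟩
  𝟙 (IsA (maxL s) (0 ∷ s)) * bWeight m (maxL s) t                ≡⟨ sumFromTo-IsA-∈ (0 ∷ s) 1 (m ∸ 1) (λ j → bWeight m j t) (n≢0⇒n>0 max≢0) (<⇒≤∸1 max<m) ⟨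
  Σb                                                              ≡⟨ cong (λ e → 𝟙 e * cWeight m t + Σb) (≢⇒≡ᵇ-false max≢0) ⟨
  𝟙 (maxL s ≡ᵇ 0) * cWeight m t + Σb                             ∎
  where
  open ≡-Reasoning
  Σb : ℕ
  Σb = sumFromTo 1 (m ∸ 1) (λ j → 𝟙 (IsA j (0 ∷ s)) * bWeight m j t)
  inRange : ℕ → Bool
  inRange v = (maxL s <ᵇ v) ∧ (v <ᵇ m)
... | no max≢0 | no max≮m = begin
  𝟙 (IsA m (0 ∷ s ++ m ∷ t))             ≡⟨ cong 𝟙 (IsA-split-max≥ s t 0<m (n≢0⇒n>0 max≢0) (≮⇒≥ max≮m)) ⟩
  0                                       ≡⟨ sumFromTo-IsA-∉ (0 ∷ s) 1 (m ∸ 1) (λ j → bWeight m j t) outside ⟨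
  Σb                                      ≡⟨ cong (λ e → 𝟙 e * cWeight m t + Σb) (≢⇒≡ᵇ-false max≢0) ⟨
  𝟙 (maxL s ≡ᵇ 0) * cWeight m t + Σb     ∎
  where
  open ≡-Reasoning
  Σb : ℕ
  Σb = sumFromTo 1 (m ∸ 1) (λ j → 𝟙 (IsA j (0 ∷ s)) * bWeight m j t)
  outside : ∀ j → 1 ≤ j → j ≤ m ∸ 1 → maxL s ≢ j
  outside j _ j≤m-1 max≡j = max≮m (subst (_< m) (sym max≡j) (≤∸1⇒< 0<m j≤m-1))

<ᵇ-+ʳ-false : ∀ m u → (m + u <ᵇ m) ≡ false
<ᵇ-+ʳ-false zero u = refl
<ᵇ-+ʳ-false (suc m) u = <ᵇ-+ʳ-false m u

∑<-below : ∀ B m (g : ℕ → ℕ) → m ≤ B → ∑< B (λ v → 𝟙 (v <ᵇ m) * g v) ≡ ∑< m g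
∑<-below B m g m≤B = begin
  ∑< B f                                  ≡⟨ cong (λ k → ∑< k f) (m+[n∸m]≡n m≤B) ⟨
  ∑< (m + (B ∸ m)) f                      ≡⟨ ∑<-+ m (B ∸ m) f ⟩
  ∑< m f + ∑< (B ∸ m) (λ u → f (m + u))  ≡⟨ cong₂ _+_ (∑<-cong m (λ v v<m → trans (cong (λ e → 𝟙 e * g v) (T-ext _ (λ _ → <⇒<ᵇ v<m))) (*-identityˡ (g v))))
                                                      (∑<-zero (B ∸ m) (λ u _ → cong (λ e → 𝟙 e * g (m + u)) (<ᵇ-+ʳ-false m u))) ⟩
  ∑< m g + 0                              ≡⟨ +-identityʳ _ ⟩
  ∑< m g                                  ∎
  where
  open ≡-Reasoning
  f : ℕ → ℕ
  f v = 𝟙 (v <ᵇ m) * g v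

∑<-between : ∀ B j m (g : ℕ → ℕ) → j < m → m ≤ B →
  ∑< B (λ v → 𝟙 ((j <ᵇ v) ∧ (v <ᵇ m)) * g v) ≡ ∑< (m ∸ j ∸ 1) (λ u → g (suc j + u))
∑<-between B j m g j<m m≤B = begin
  ∑< B (λ v → 𝟙 ((j <ᵇ v) ∧ (v <ᵇ m)) * g v)
    ≡⟨ ∑<-cong B (λ v _ → trans (cong (_* g v) (trans (𝟙-∧ (j <ᵇ v) _) (*-comm (𝟙 (j <ᵇ v)) _))) (*-assoc (𝟙 (v <ᵇ m)) _ _)) ⟩
  ∑< B (λ v → 𝟙 (v <ᵇ m) * f v)                    ≡⟨ ∑<-below B m f m≤B ⟩
  ∑< m f                                            ≡⟨ cong (λ l → ∑< l f) m≡ ⟨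
  ∑< (suc j + k) f                                  ≡⟨ ∑<-+ (suc j) k f ⟩
  ∑< (suc j) f + ∑< k (λ u → f (suc j + u))        ≡⟨ cong₂ _+_ (∑<-zero (suc j) (λ v v≤j → cong (λ e → 𝟙 e * g v) (T-ext (λ j<v → <⇒≱ (<ᵇ⇒< j v j<v) (≤-pred v≤j)) λ ())))
                                                                  (∑<-cong k (λ u _ → trans (cong (λ e → 𝟙 e * g (suc j + u)) (T-ext _ (λ _ → <⇒<ᵇ (m≤m+n (suc j) u)))) (*-identityˡ _))) ⟩
  ∑< k (λ u → g (suc j + u))                        ∎
  where
  open ≡-Reasoning
  f : ℕ → ℕ
  f v = 𝟙 (j <ᵇ v) * g v
  k : ℕ
  k = m ∸ j ∸ 1
  m≡ : suc j + k ≡ m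
  m≡ = trans (cong (suc j +_) (trans (∸-+-assoc m j 1) (cong (m ∸_) (+-comm j 1)))) (m+[n∸m]≡n j<m)

allDistinct-shift : ∀ c xs → allDistinct (map (c +_) xs) ≡ allDistinct xs
allDistinct-shift c [] = refl
allDistinct-shift c (x ∷ xs) = cong₂ (λ o d → (o ≡ᵇ 0) ∧ d) (occurs-shift xs) (allDistinct-shift c xs)
  where
  occurs-shift : ∀ xs → occurs (c + x) (map (c +_) xs) ≡ occurs x xs
  occurs-shift [] = refl
  occurs-shift (y ∷ xs) rewrite ≡ᵇ-+ˡ c y x | occurs-shift xs = refl

∑seq-cWeight : ∀ b r m → (∀ i → m ≤ b i) → ∑seq b r (cWeight m) ≡ 𝔠 r m
∑seq-cWeight b r m m≤b = begin
  ∑seq b r (cWeight m)               ≡⟨ ∑seq-reindex b (λ _ → m) (_<ᵇ m) (λ u → u) (λ i g → ∑<-below (b i) m g (m≤b i)) r (𝟙 ∘ IsC) ⟩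
  ∑seq (λ _ → m) r (𝟙 ∘ IsC ∘ map (λ u → u))
                                      ≡⟨ ∑seq-cong (λ _ → m) r (cong (𝟙 ∘ IsC) ∘ map-id) ⟩
  ∑seq (λ _ → m) r (𝟙 ∘ IsC)        ≡⟨ count≡∑seq IsC (λ _ → m) r ⟨
  𝔠 r m                              ∎
  where open ≡-Reasoning

∑seq-bWeight : ∀ b r m j → j < m → (∀ i → m ≤ b i) → ∑seq b r (bWeight m j) ≡ 𝔟 r (m ∸ j ∸ 1)
∑seq-bWeight b r m j j<m m≤b = begin
  ∑seq b r (bWeight m j)             ≡⟨ ∑seq-reindex b (λ _ → k) (λ v → (j <ᵇ v) ∧ (v <ᵇ m)) (suc j +_)
                                                     (λ i g → ∑<-between (b i) j m g j<m (m≤b i)) r (𝟙 ∘ IsB) ⟩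
  ∑seq (λ _ → k) r (𝟙 ∘ IsB ∘ map (suc j +_))
                                      ≡⟨ ∑seq-cong (λ _ → k) r (λ u → cong 𝟙 (cong₂ _∧_ (cong not (contains-shift (suc j) pat120 u)) (allDistinct-shift (suc j) u))) ⟩
  ∑seq (λ _ → k) r (𝟙 ∘ IsB)        ≡⟨ count≡∑seq IsB (λ _ → k) r ⟨
  𝔟 r k                              ∎
  where
  open ≡-Reasoning
  k : ℕ
  k = m ∸ j ∸ 1

-- Letters are indexed from 0; past the end the value is 0.
at : List ℕ → ℕ → ℕ
at [] _ = 0
at (x ∷ xs) zero = x
at (x ∷ xs) (suc i) = at xs i

at-++-length : ∀ s v t → at (s ++ v ∷ t) (length s) ≡ v
at-++-length [] v t = refl
at-++-length (x ∷ s) v t = at-++-length s v t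

at-++ˡ : ∀ s u i → i < length s → at (s ++ u) i ≡ at s i
at-++ˡ (x ∷ s) u zero _ = refl
at-++ˡ (x ∷ s) u (suc i) (s≤s i<) = at-++ˡ s u i i<

Bounded-length : ∀ {b n s} → Bounded b n s → length s ≡ n
Bounded-length [] = refl
Bounded-length (snoc {n} {s} bs _) = trans (length-++ s) (trans (cong (_+ 1) (Bounded-length bs)) (+-comm n 1))

Bounded-at : ∀ {b n σ} → Bounded b n σ → ∀ i → i < n → at σ i < b (suc i)
Bounded-at (snoc {n} {s} {v} bs v<) i i<1+n with m≤n⇒m<n∨m≡n (≤-pred i<1+n)
... | inj₁ i<n = subst (_< _) (sym (at-++ˡ s (v ∷ []) i (subst (i <_) (sym (Bounded-length bs)) i<n))) (Bounded-at bs i i<n)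
... | inj₂ refl = subst (_< _) (sym (trans (cong (at (s ++ v ∷ [])) (sym (Bounded-length bs))) (at-++-length s v []))) v<

Bounded-head : ∀ {n s} → 0 < n → Bounded (λ i → i) n s → ∃ λ s' → s ≡ 0 ∷ s'
Bounded-head _ (snoc [] (s≤s z≤n)) = [] , refl
Bounded-head _ (snoc {v = v} bs@(snoc _ _) _) = let s' , eq = Bounded-head (s≤s z≤n) bs in s' ++ v ∷ [] , cong (_++ v ∷ []) eq

∑<-at≡occurs : ∀ m σ → ∑< (length σ) (λ i → 𝟙 (at σ i ≡ᵇ m)) ≡ occurs m σ
∑<-at≡occurs m [] = refl
∑<-at≡occurs m (x ∷ xs) = trans (∑<-sucˡ (length xs) _) (trans (cong (𝟙 (x ≡ᵇ m) +_) (∑<-at≡occurs m xs)) (count-head (x ≡ᵇ m)))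
  where
  count-head : ∀ e → 𝟙 e + occurs m xs ≡ (if e then suc (occurs m xs) else occurs m xs)
  count-head true = refl
  count-head false = refl

IsA-occurs≡1 : ∀ {n σ m} → 0 < m → 0 < n → Bounded (λ i → i) n σ → T (IsA m σ) → occurs m σ ≡ 1
IsA-occurs≡1 {m = suc m} 0<m 0<n bs a with Bounded-head 0<n bs
... | ρ , refl with IsA-0∷⁻ ρ a
...   | nz , _ , max≡m = ≤-antisym (occurs≤1 ρ nz (>⇒≢ 0<m)) (occurs-pos ρ (subst (_∈ ρ) max≡m (maxL∈ ρ (subst (0 <_) (sym max≡m) 0<m))))

-- In an inversion sequence the letter m can only occur from position m + 1 on.
𝟙-IsA≡∑position : ∀ {n m σ} → 0 < m → m < n → Bounded (λ i → i) n σ →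
  𝟙 (IsA m σ) ≡ sumFromTo (m + 1) n (λ p → 𝟙 (IsA m σ) * 𝟙 (at σ (p ∸ 1) ≡ᵇ m))
𝟙-IsA≡∑position {n} {m} {σ} 0<m m<n bs with IsA m σ in isA
... | false = sym (sumFromTo-zero (m + 1) n (λ _ _ _ → refl))
... | true = sym (begin
  sumFromTo (m + 1) n (λ p → 1 * 𝟙 (at σ (p ∸ 1) ≡ᵇ m))         ≡⟨ sumFromTo≡∑< (m + 1) n (λ p → 1 * 𝟙 (at σ (p ∸ 1) ≡ᵇ m)) ⟩
  ∑< (suc n ∸ (m + 1)) (λ i → 1 * 𝟙 (at σ (m + 1 + i ∸ 1) ≡ᵇ m)) ≡⟨ trans (cong (λ k → ∑< (suc n ∸ k) (λ i → 1 * 𝟙 (at σ (m + 1 + i ∸ 1) ≡ᵇ m))) (+-comm m 1)) (∑<-cong (n ∸ m) λ i _ → trans (*-identityˡ _) (cong (λ k → 𝟙 (at σ k ≡ᵇ m)) (index i))) ⟩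
  ∑< (n ∸ m) (λ i → 𝟙 (at σ (m + i) ≡ᵇ m))                        ≡⟨ cong (_+ ∑< (n ∸ m) (λ i → 𝟙 (at σ (m + i) ≡ᵇ m))) (∑<-zero m (λ i i<m → cong 𝟙 (≢⇒≡ᵇ-false (<⇒≢ (<-≤-trans (Bounded-at bs i (<-trans i<m m<n)) i<m))))) ⟨
  ∑< m f + ∑< (n ∸ m) (λ i → f (m + i))                           ≡⟨ ∑<-+ m (n ∸ m) f ⟨
  ∑< (m + (n ∸ m)) f                                               ≡⟨ cong (λ k → ∑< k f) (trans (m+[n∸m]≡n (<⇒≤ m<n)) (sym (Bounded-length bs))) ⟩
  ∑< (length σ) f                                                  ≡⟨ ∑<-at≡occurs m σ ⟩
  occurs m σ                                                       ≡⟨ IsA-occurs≡1 0<m (<-trans 0<m m<n) bs (from T-≡ isA) ⟩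
  1                                                                ∎)
  where
  open ≡-Reasoning
  f : ℕ → ℕ
  f i = 𝟙 (at σ i ≡ᵇ m)
  index : ∀ i → m + 1 + i ∸ 1 ≡ m + i
  index i = cong (_∸ 1) (trans (+-assoc m 1 i) (+-suc m i))

∑seq-maxL≡0 : ∀ q → ∑seq (λ i → i) q (λ s → 𝟙 (maxL s ≡ᵇ 0)) ≡ 1
∑seq-maxL≡0 zero = refl
∑seq-maxL≡0 (suc q) = trans (∑seq-cong (λ i → i) q only-zero) (∑seq-maxL≡0 q)
  where
  only-zero : ∀ s → ∑< (suc q) (λ v → 𝟙 (maxL (s ++ v ∷ []) ≡ᵇ 0)) ≡ 𝟙 (maxL s ≡ᵇ 0)
  only-zero s = begin
    ∑< (suc q) (λ v → 𝟙 (maxL (s ++ v ∷ []) ≡ᵇ 0))     ≡⟨ ∑<-cong (suc q) (λ v _ → cong (λ k → 𝟙 (k ≡ᵇ 0)) (trans (maxL-++ s (v ∷ [])) (cong (maxL s ⊔_) (⊔-identityʳ v)))) ⟩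
    ∑< (suc q) (λ v → 𝟙 (maxL s ⊔ v ≡ᵇ 0))              ≡⟨ ∑<-sucˡ q _ ⟩
    𝟙 (maxL s ⊔ 0 ≡ᵇ 0) + ∑< q (λ v → 𝟙 (maxL s ⊔ suc v ≡ᵇ 0))
                                                         ≡⟨ cong₂ _+_ (cong (λ k → 𝟙 (k ≡ᵇ 0)) (⊔-identityʳ (maxL s)))
                                                                      (∑<-zero q (λ v _ → cong 𝟙 (≢⇒≡ᵇ-false (>⇒≢ (≤-trans (s≤s z≤n) (m≤n⊔m (maxL s) (suc v))))))) ⟩
    𝟙 (maxL s ≡ᵇ 0) + 0                                  ≡⟨ +-identityʳ _ ⟩
    𝟙 (maxL s ≡ᵇ 0)                                      ∎
    where open ≡-Reasoning

-- Counting by the position q + 1 of the maximum m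

module _ (q r m : ℕ) (0<m : 0 < m) (m≤q : m ≤ q) where

  private
    -- the inversion-sequence bounds at the positions after q + 1
    b : ℕ → ℕ
    b i = q + suc i

    m≤b : ∀ i → m ≤ b i
    m≤b i = ≤-trans m≤q (m≤m+n q (suc i))

    G : List ℕ → ℕ
    G σ = 𝟙 (IsA m σ) * 𝟙 (at σ q ≡ᵇ m)

    C : ℕ
    C = ∑seq b r (cWeight m)

    B : ℕ → ℕ
    B j = ∑seq b r (bWeight m j)

    after-prefix : ∀ s' → ∑seq b r (λ t → 𝟙 (IsA m (0 ∷ s' ++ m ∷ t))) ≡
      𝟙 (maxL s' ≡ᵇ 0) * C + sumFromTo 1 (m ∸ 1) (λ j → 𝟙 (IsA j (0 ∷ s')) * B j)
    after-prefix s' = begin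
      ∑seq b r (λ t → 𝟙 (IsA m (0 ∷ s' ++ m ∷ t)))
        ≡⟨ ∑seq-cong b r (λ t → 𝟙-IsA-split s' t 0<m) ⟩
      ∑seq b r (λ t → 𝟙 (maxL s' ≡ᵇ 0) * cWeight m t + sumFromTo 1 (m ∸ 1) (λ j → 𝟙 (IsA j (0 ∷ s')) * bWeight m j t))
        ≡⟨ ∑seq-distrib-+ b r (λ t → 𝟙 (maxL s' ≡ᵇ 0) * cWeight m t) (λ t → sumFromTo 1 (m ∸ 1) (λ j → 𝟙 (IsA j (0 ∷ s')) * bWeight m j t)) ⟩
      ∑seq b r (λ t → 𝟙 (maxL s' ≡ᵇ 0) * cWeight m t) + ∑seq b r (λ t → sumFromTo 1 (m ∸ 1) (λ j → 𝟙 (IsA j (0 ∷ s')) * bWeight m j t))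
        ≡⟨ cong₂ _+_ (∑seq-*ˡ b r (𝟙 (maxL s' ≡ᵇ 0)) (cWeight m)) (∑seq-sumFromTo b r 1 (m ∸ 1) (λ j t → 𝟙 (IsA j (0 ∷ s')) * bWeight m j t)) ⟩
      𝟙 (maxL s' ≡ᵇ 0) * C + sumFromTo 1 (m ∸ 1) (λ j → ∑seq b r (λ t → 𝟙 (IsA j (0 ∷ s')) * bWeight m j t))
        ≡⟨ cong (𝟙 (maxL s' ≡ᵇ 0) * C +_) (sumFromTo-cong 1 (m ∸ 1) (λ j _ _ → ∑seq-*ˡ b r (𝟙 (IsA j (0 ∷ s'))) (bWeight m j))) ⟩
      𝟙 (maxL s' ≡ᵇ 0) * C + sumFromTo 1 (m ∸ 1) (λ j → 𝟙 (IsA j (0 ∷ s')) * B j)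
        ∎
      where open ≡-Reasoning

    at-prefix : ∀ s → Bounded (λ i → i) q s →
      ∑< (q + 1) (λ v → ∑seq b r (λ t → G (s ++ v ∷ t))) ≡ 𝟙 (maxL s ≡ᵇ 0) * C + sumFromTo 1 (m ∸ 1) (λ j → 𝟙 (IsA j s) * B j)
    at-prefix s bs with Bounded-head (<-≤-trans 0<m m≤q) bs
    ... | s' , refl = begin
      ∑< (q + 1) (λ v → ∑seq b r (λ t → G (s ++ v ∷ t)))
        ≡⟨ ∑<-cong (q + 1) (λ v _ → trans (∑seq-cong b r (λ t → cong (λ k → 𝟙 (IsA m (s ++ v ∷ t)) * 𝟙 (k ≡ᵇ m)) (at-q v t)))
                                         (∑seq-*ʳ b r (𝟙 (v ≡ᵇ m)) (λ t → 𝟙 (IsA m (s ++ v ∷ t))))) ⟩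
      ∑< (q + 1) (λ v → ∑seq b r (λ t → 𝟙 (IsA m (s ++ v ∷ t))) * 𝟙 (v ≡ᵇ m))
        ≡⟨ ∑<-cong (q + 1) (λ v _ → trans (*-comm (A v) (𝟙 (v ≡ᵇ m))) (cong (λ e → 𝟙 e * A v) (≡ᵇ-comm v m))) ⟩
      ∑< (q + 1) (λ v → 𝟙 (m ≡ᵇ v) * ∑seq b r (λ t → 𝟙 (IsA m (s ++ v ∷ t))))
        ≡⟨ ∑<-δ (q + 1) m (λ v → ∑seq b r (λ t → 𝟙 (IsA m (s ++ v ∷ t)))) (subst (m <_) (+-comm 1 q) (s≤s m≤q)) ⟩
      ∑seq b r (λ t → 𝟙 (IsA m (s ++ m ∷ t)))
        ≡⟨ after-prefix s' ⟩
      𝟙 (maxL s ≡ᵇ 0) * C + sumFromTo 1 (m ∸ 1) (λ j → 𝟙 (IsA j s) * B j)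
        ∎
      where
      open ≡-Reasoning
      A : ℕ → ℕ
      A v = ∑seq b r (λ t → 𝟙 (IsA m (s ++ v ∷ t)))
      at-q : ∀ v t → at (s ++ v ∷ t) q ≡ v
      at-q v t = trans (cong (at (s ++ v ∷ t)) (sym (Bounded-length bs))) (at-++-length s v t)

  ∑seq-IsA-max-at : ∑seq (λ i → i) (q + suc r) (λ σ → 𝟙 (IsA m σ) * 𝟙 (at σ q ≡ᵇ m)) ≡
    𝔠 r m + sumFromTo 1 (m ∸ 1) (λ j → 𝔞 q j * 𝔟 r (m ∸ j ∸ 1))
  ∑seq-IsA-max-at = begin
    ∑seq (λ i → i) (q + suc r) G
      ≡⟨ ∑seq-++ (λ i → i) q (suc r) G ⟩
    ∑seq (λ i → i) q (λ s → ∑seq (q +_) (suc r) (λ u → G (s ++ u)))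
      ≡⟨ ∑seq-cong (λ i → i) q (λ s → ∑seq-++ (q +_) 1 r (λ u → G (s ++ u))) ⟩
    ∑seq (λ i → i) q (λ s → ∑< (q + 1) (λ v → ∑seq b r (λ t → G (s ++ v ∷ t))))
      ≡⟨ ∑seq-cong-bounded (λ i → i) q at-prefix ⟩
    ∑seq (λ i → i) q (λ s → 𝟙 (maxL s ≡ᵇ 0) * C + sumFromTo 1 (m ∸ 1) (λ j → 𝟙 (IsA j s) * B j))
      ≡⟨ ∑seq-distrib-+ (λ i → i) q (λ s → 𝟙 (maxL s ≡ᵇ 0) * C) (λ s → sumFromTo 1 (m ∸ 1) (λ j → 𝟙 (IsA j s) * B j)) ⟩
    ∑seq (λ i → i) q (λ s → 𝟙 (maxL s ≡ᵇ 0) * C) + ∑seq (λ i → i) q (λ s → sumFromTo 1 (m ∸ 1) (λ j → 𝟙 (IsA j s) * B j))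
      ≡⟨ cong₂ _+_ (∑seq-*ʳ (λ i → i) q C (λ s → 𝟙 (maxL s ≡ᵇ 0))) (∑seq-sumFromTo (λ i → i) q 1 (m ∸ 1) (λ j s → 𝟙 (IsA j s) * B j)) ⟩
    ∑seq (λ i → i) q (λ s → 𝟙 (maxL s ≡ᵇ 0)) * C + sumFromTo 1 (m ∸ 1) (λ j → ∑seq (λ i → i) q (λ s → 𝟙 (IsA j s) * B j))
      ≡⟨ cong₂ _+_ (trans (cong (_* C) (∑seq-maxL≡0 q)) (*-identityˡ C))
                   (sumFromTo-cong 1 (m ∸ 1) (λ j _ _ → trans (∑seq-*ʳ (λ i → i) q (B j) (𝟙 ∘ IsA j)) (cong (_* B j) (sym (count≡∑seq (IsA j) (λ i → i) q))))) ⟩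
    C + sumFromTo 1 (m ∸ 1) (λ j → 𝔞 q j * B j)
      ≡⟨ cong₂ _+_ (∑seq-cWeight b r m m≤b) (sumFromTo-cong 1 (m ∸ 1) (λ j _ j≤ → cong (𝔞 q j *_) (∑seq-bWeight b r m j (≤∸1⇒< 0<m j≤) m≤b))) ⟩
    𝔠 r m + sumFromTo 1 (m ∸ 1) (λ j → 𝔞 q j * 𝔟 r (m ∸ j ∸ 1))
      ∎
    where
    open ≡-Reasoning

theorem10 : (n m : ℕ) → 0 < m → m < n →
    𝔞 n m ≡ sumFromTo (m + 1) n (λ p →
      𝔠 (n ∸ p) m + sumFromTo 1 (m ∸ 1) (λ j → 𝔞 (p ∸ 1) j * 𝔟 (n ∸ p) (m ∸ j ∸ 1)))
theorem10 n m 0<m m<n = begin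
  𝔞 n m                                                       ≡⟨ count≡∑seq (IsA m) (λ i → i) n ⟩
  ∑seq (λ i → i) n (𝟙 ∘ IsA m)                               ≡⟨ ∑seq-cong-bounded (λ i → i) n (λ σ → 𝟙-IsA≡∑position 0<m m<n) ⟩
  ∑seq (λ i → i) n (λ σ → sumFromTo (m + 1) n (λ p → G p σ)) ≡⟨ ∑seq-sumFromTo (λ i → i) n (m + 1) n G ⟩
  sumFromTo (m + 1) n (λ p → ∑seq (λ i → i) n (G p))         ≡⟨ sumFromTo-cong (m + 1) n max-at ⟩
  sumFromTo (m + 1) n (λ p → 𝔠 (n ∸ p) m + sumFromTo 1 (m ∸ 1) (λ j → 𝔞 (p ∸ 1) j * 𝔟 (n ∸ p) (m ∸ j ∸ 1))) ∎
  where
  open ≡-Reasoning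
  G : ℕ → List ℕ → ℕ
  G p σ = 𝟙 (IsA m σ) * 𝟙 (at σ (p ∸ 1) ≡ᵇ m)
  max-at : ∀ p → m + 1 ≤ p → p ≤ n →
    ∑seq (λ i → i) n (G p) ≡ 𝔠 (n ∸ p) m + sumFromTo 1 (m ∸ 1) (λ j → 𝔞 (p ∸ 1) j * 𝔟 (n ∸ p) (m ∸ j ∸ 1))
  max-at zero m+1≤0 _ with () ← subst (_≤ 0) (+-comm m 1) m+1≤0
  max-at (suc q) m+1≤p p≤n = trans (cong (λ k → ∑seq (λ i → i) k (G (suc q))) (sym n≡))
                                   (∑seq-IsA-max-at q (n ∸ suc q) m 0<m (≤-pred (subst (_≤ suc q) (+-comm m 1) m+1≤p)))
    where
    n≡ : q + suc (n ∸ suc q) ≡ n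
    n≡ = trans (+-suc q (n ∸ suc q)) (m+[n∸m]≡n p≤n)
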